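{- Let $\alpha$ be a real number and let $p,q,r,n$ be non-negative integers with $p\geq n$. Then \[ B_{n}^{(\alpha)}(r)=(\alpha+q)\binom{\alpha+q+p}{p}\sum_{j=0}^{p}\frac{(-1)^{j}}{\alpha+q+j}\binom{p}{j}\frac{\genfrac{\{}{\}}{0pt}{}{n+r+q+j}{r+q+j}_{r}}{\binom{n+q+j}{n}}, \] \[ b_{n}^{(\alpha)}(r)=(n+1-\alpha+q)\binom{n+1-\alpha+q+p}{p}\sum_{j=0}^{p}\frac{(-1)^{j}}{n+1-\alpha+q+j}\binom{p}{j}\frac{\genfrac{\{}{\}}{0pt}{}{n+r+q+j+1}{r+q+j+1}_{r+1}}{\binom{n+q+j}{n}}. \]
   Context: The higher order Bernoulli polynomials are defined by $\sum_{n\ge0}B_n^{(\alpha)}(x)\frac{t^n}{n!}=\left(\frac{t}{e^t-1}\right)^{\alpha}e^{xt}$ and $\sum_{n\ge0}b_n^{(\alpha)}(x)\frac{t^n}{n!}=\left(\frac{t}{\ln(1+t)}\right)^{\alpha}(1+t)^{x}$. For non-negative integers $r,k$, the $r$-Stirling numbers of the second kind $\genfrac{\{}{\}}{0pt}{}{n+r}{k+r}_r$ (number of partitions of $\{1,\dots,n+r\}$ into $k+r$ non-empty blocks with $1,\dots,r$ in distinct blocks) are given by $\sum_{n\ge k}\genfrac{\{}{\}}{0pt}{}{n+r}{k+r}_r\frac{t^n}{n!}=\frac{1}{k!}(e^t-1)^k e^{rt}$. For real $x$, $\binom{x}{k}=\frac{x(x-1)\cdots(x-k+1)}{k!}$ ($k\ge1$),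 $\binom{x}{0}=1$. An expression $\frac{\beta}{\beta+j}\binom{\beta+p}{p}$ ($0\le j\le p$) is understood as the polynomial $\frac{\beta(\beta+1)\cdots(\beta+p)}{p!\,(\beta+j)}$ in $\beta$.
   Formalization: The parameter α ranges over the rationals instead of the real numbers. -}

module Defs where

open import Data.Nat as ℕ using (ℕ; zero; suc; _∸_)
open import Data.Nat.Combinatorics using (_C_)
open import Data.Nat.Base using (_!)
open import Data.Integer as ℤ using (+_)
open import Data.Rational using (ℚ; 0ℚ; 1ℚ; _+_; _*_; _-_; -_; _/_)
open import Relation.Nullary using (yes; no)

ℕ→ℚ : ℕ → ℚ
ℕ→ℚ n = + n / 1

-- 1/m for m ≥ 1 (only ever applied to positive arguments; 1/0 := 0 is a dummy)
recipℕ : ℕ → ℚ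
recipℕ zero    = 0ℚ
recipℕ (suc m) = + 1 / suc m

invFact : ℕ → ℚ
invFact zero    = 1ℚ
invFact (suc k) = invFact k * recipℕ (suc k)

sgn : ℕ → ℚ
sgn zero    = 1ℚ
sgn (suc j) = - sgn j

Σ≤ : ℕ → (ℕ → ℚ) → ℚ
Σ≤ zero    f = f 0
Σ≤ (suc p) f = Σ≤ p f + f (suc p)

Π≤ : ℕ → (ℕ → ℚ) → ℚ
Π≤ zero    f = f 0
Π≤ (suc p) f = Π≤ p f * f (suc p)

binom : ℚ → ℕ → ℚ
binom x zero    = 1ℚ
binom x (suc k) = binom x k * (x - ℕ→ℚ k) * recipℕ (suc k)

-- Formal power series over ℚ in t, given by (ordinary) coefficients:
-- f n = [t^n] f.

Series : Set
Series = ℕ → ℚ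

_⊕_ : Series → Series → Series
(f ⊕ g) n = f n + g n

_⊗_ : Series → Series → Series
(f ⊗ g) n = Σ≤ n (λ i → f i * g (n ∸ i))

scale : ℚ → Series → Series
scale c f n = c * f n

oneS : Series
oneS zero    = 1ℚ
oneS (suc n) = 0ℚ

minus1 : Series → Series
minus1 f zero    = f zero - 1ℚ
minus1 f (suc n) = f (suc n)

_^S_ : Series → ℕ → Series
f ^S zero    = oneS
f ^S (suc m) = (f ^S m) ⊗ f

-- f^a := Σ_m binom a m (f-1)^m, for f with constant term 1 and a ∈ ℚ.
-- (f-1)^m has no terms below t^m, so the coefficient of t^n only
-- involves m ≤ n.
powS : Series → ℚ → Series
powS f a n = Σ≤ n (λ m → binom a m * ((minus1 f ^S m) n))

_^Q_ : ℚ → ℕ → ℚ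
x ^Q zero    = 1ℚ
x ^Q (suc n) = (x ^Q n) * x

expS : ℚ → Series
expS x n = (x ^Q n) * invFact n

expm1 : Series
expm1 = minus1 (expS 1ℚ)

expm1/t : Series
expm1/t k = invFact (suc k)

log1p/t : Series
log1p/t k = sgn k * recipℕ (suc k)

onePlusT : Series
onePlusT zero          = 1ℚ
onePlusT (suc zero)    = 1ℚ
onePlusT (suc (suc n)) = 0ℚ

-- Higher order Bernoulli polynomials (exponential generating functions)
--   Σ B_n^{(α)}(x) t^n/n! = (t/(e^t-1))^α e^{xt}
-- where (t/(e^t-1))^α = ((e^t-1)/t)^(-α).

bernoulliB : ℕ → ℚ → ℚ → ℚ
bernoulliB n α x = ℕ→ℚ (n !) * (powS expm1/t (- α) ⊗ expS x) n

--   Σ b_n^{(α)}(x) t^n/n! = (t/ln(1+t))^α (1+t)^x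
-- where (t/ln(1+t))^α = (ln(1+t)/t)^(-α).

bernoulliB2 : ℕ → ℚ → ℚ → ℚ
bernoulliB2 n α x = ℕ→ℚ (n !) * (powS log1p/t (- α) ⊗ powS onePlusT x) n

-- r-Stirling numbers of the second kind:
--   rStirling r n k  =  {n+r \brace k+r}_r
-- defined by  Σ_{n} {n+r \brace k+r}_r t^n/n! = (1/k!) (e^t-1)^k e^{rt}.

rStirling : ℕ → ℕ → ℕ → ℚ
rStirling r n k = ℕ→ℚ (n !) * (scale (invFact k) ((expm1 ^S k) ⊗ expS (ℕ→ℚ r))) n

-- The polynomial  β/(β+j) * binom (β+p) p  =  β(β+1)...(β+p) / (p! (β+j)),
-- i.e. (1/p!) Π_{0 ≤ i ≤ p, i ≠ j} (β + i).

coefP : ℚ → ℕ → ℕ → ℚ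
coefP β p j = invFact p * Π≤ p (λ i → skip i)
  where
  skip : ℕ → ℚ
  skip i with i ℕ.≟ j
  ... | yes _ = 1ℚ
  ... | no  _ = β + ℕ→ℚ i

-- For fixed n, q, r each left-hand side is a polynomial of degree at most n ≤ p in
-- β = α + q (resp. β = n + 1 − α + q), and β ↦ coefP β p j · (−1)^j · C(p,j) is the
-- Lagrange basis for the nodes β = 0, −1, …, −p.  So it suffices to check the values at
-- β = −j.  There the exponent α = −(q + j) turns (t/(e^t − 1))^α into ((e^t − 1)/t)^(q+j),
-- whose product with e^(rt) is, up to the binomial, the generating function of the
-- r-Stirling numbers.  For b the exponent is α = n + 1 + q + j, and the Lagrange inversion
--   [t^n] (t/ln(1+t))^(n+1+m) (1+t)^r  =  [t^n] ((e^t − 1)/t)^m e^((r+1)t)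
-- (e^t − 1 and ln(1 + t) are inverse series) reduces it to the first case with r + 1.  The
-- inversion formula is proved by showing that both sides obey the same recurrence in n and
-- m, derived by applying the Euler operator θ = t d/dt to the two generating functions.
module Submission where

open import Defs
open import Algebra.Bundles using (CommutativeRing)
open import Algebra.Structures using (IsCommutativeRing)
import Algebra.Solver.Ring as RingSolver
import Algebra.Solver.Ring.AlmostCommutativeRing as ACR
open import Data.Empty using (⊥-elim)
import Data.Integer as ℤ
import Data.Integer.Properties as ℤP
open import Data.List using (List; []; _∷_; length; map)
open import Data.List.Properties using (length-map)
open import Data.Maybe using (Maybe; just; nothing)
open import Data.Nat as ℕ using (ℕ; zero; suc; _≤_; _<_; _∸_; z≤n; s≤s; _!)
  renaming (_+_ to _+ℕ_; _*_ to _*ℕ_)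
open import Data.Nat.Combinatorics using (_C_; nCk≡n!/k![n-k]!; k![n∸k]!∣n!)
import Data.Nat.Coprimality as Coprimality
open import Data.Nat.DivMod using (m/n*n≡m)
import Data.Nat.Properties as ℕP
open import Data.Product using (Σ; _×_; _,_; proj₁)
open import Data.Rational as ℚ using (ℚ; 0ℚ; 1ℚ; _+_; _*_; _-_; -_; mkℚ; toℚᵘ)
open import Data.Rational.Properties
import Data.Rational.Unnormalised as ℚᵘ
import Data.Rational.Unnormalised.Properties as ℚᵘP
open import Data.Sum using (_⊎_; inj₁; inj₂)
open import Relation.Binary.PropositionalEquality
open import Relation.Binary.Structures using (IsEquivalence)
open import Relation.Nullary using (yes; no)
open import Tactic.RingSolver using (solve-∀)
open import Tactic.RingSolver.Core.AlmostCommutativeRing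
  using (AlmostCommutativeRing; fromCommutativeRing)

open ≡-Reasoning

ℚ-ring : AlmostCommutativeRing _ _
ℚ-ring = fromCommutativeRing +-*-commutativeRing is-zero
  where
  is-zero : ∀ x → Maybe (0ℚ ≡ x)
  is-zero x with 0ℚ ≟ x
  ... | yes e = just e
  ... | no _  = nothing

ℕ→ℚ≡mkℚ : ∀ n → ℕ→ℚ n ≡ mkℚ (ℤ.+ n) 0 (Coprimality.sym (Coprimality.1-coprimeTo n))
ℕ→ℚ≡mkℚ n = normalize-coprime (Coprimality.sym (Coprimality.1-coprimeTo n))

ℕ→ℚ-suc : ∀ n → ℕ→ℚ (suc n) ≡ 1ℚ + ℕ→ℚ n
ℕ→ℚ-suc n = toℚᵘ-injective (ℚᵘP.≃-trans unnormalised (ℚᵘP.≃-sym (toℚᵘ-homo-+ 1ℚ (ℕ→ℚ n))))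
  where
  unnormalised : toℚᵘ (ℕ→ℚ (suc n)) ℚᵘ.≃ (toℚᵘ 1ℚ ℚᵘ.+ toℚᵘ (ℕ→ℚ n))
  unnormalised rewrite ℕ→ℚ≡mkℚ n | ℕ→ℚ≡mkℚ (suc n) = ℚᵘ.*≡* cross-multiplied
    where
    cross-multiplied : ℤ.+ suc n ℤ.* ℤ.+ 1 ≡ (ℤ.+ 1 ℤ.* ℤ.+ 1 ℤ.+ ℤ.+ n ℤ.* ℤ.+ 1) ℤ.* ℤ.+ 1
    cross-multiplied rewrite ℤP.*-identityʳ (ℤ.+ suc n) | ℤP.*-identityʳ (ℤ.+ n)
                           | ℤP.*-identityʳ (ℤ.+ 1 ℤ.+ ℤ.+ n) = ℤP.pos-+ 1 n

ℕ→ℚ-+ : ∀ m n → ℕ→ℚ (m +ℕ n) ≡ ℕ→ℚ m + ℕ→ℚ n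
ℕ→ℚ-+ zero    n = sym (+-identityˡ (ℕ→ℚ n))
ℕ→ℚ-+ (suc m) n = begin
  ℕ→ℚ (suc (m +ℕ n))     ≡⟨ ℕ→ℚ-suc (m +ℕ n) ⟩
  1ℚ + ℕ→ℚ (m +ℕ n)      ≡⟨ cong (1ℚ +_) (ℕ→ℚ-+ m n) ⟩
  1ℚ + (ℕ→ℚ m + ℕ→ℚ n)   ≡⟨ sym (+-assoc 1ℚ (ℕ→ℚ m) (ℕ→ℚ n)) ⟩
  (1ℚ + ℕ→ℚ m) + ℕ→ℚ n   ≡⟨ cong (_+ ℕ→ℚ n) (sym (ℕ→ℚ-suc m)) ⟩
  ℕ→ℚ (suc m) + ℕ→ℚ n    ∎

ℕ→ℚ-* : ∀ m n → ℕ→ℚ (m *ℕ n) ≡ ℕ→ℚ m * ℕ→ℚ n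
ℕ→ℚ-* zero    n = sym (*-zeroˡ (ℕ→ℚ n))
ℕ→ℚ-* (suc m) n = begin
  ℕ→ℚ (n +ℕ m *ℕ n)          ≡⟨ ℕ→ℚ-+ n (m *ℕ n) ⟩
  ℕ→ℚ n + ℕ→ℚ (m *ℕ n)       ≡⟨ cong (ℕ→ℚ n +_) (ℕ→ℚ-* m n) ⟩
  ℕ→ℚ n + ℕ→ℚ m * ℕ→ℚ n      ≡⟨ factor (ℕ→ℚ n) (ℕ→ℚ m) ⟩
  (1ℚ + ℕ→ℚ m) * ℕ→ℚ n       ≡⟨ cong (_* ℕ→ℚ n) (sym (ℕ→ℚ-suc m)) ⟩
  ℕ→ℚ (suc m) * ℕ→ℚ n        ∎
  where
  factor : ∀ a b → a + b * a ≡ (1ℚ + b) * a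
  factor = solve-∀ ℚ-ring

ℕ→ℚ-∸ : ∀ m n → n ≤ m → ℕ→ℚ (m ∸ n) ≡ ℕ→ℚ m - ℕ→ℚ n
ℕ→ℚ-∸ m n n≤m = begin
  ℕ→ℚ (m ∸ n)                    ≡⟨ add-sub (ℕ→ℚ (m ∸ n)) (ℕ→ℚ n) ⟩
  (ℕ→ℚ (m ∸ n) + ℕ→ℚ n) - ℕ→ℚ n  ≡⟨ cong (_- ℕ→ℚ n) (sym (ℕ→ℚ-+ (m ∸ n) n)) ⟩
  ℕ→ℚ (m ∸ n +ℕ n) - ℕ→ℚ n       ≡⟨ cong (λ k → ℕ→ℚ k - ℕ→ℚ n) (ℕP.m∸n+n≡m n≤m) ⟩
  ℕ→ℚ m - ℕ→ℚ n                  ∎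
  where
  add-sub : ∀ a b → a ≡ (a + b) - b
  add-sub = solve-∀ ℚ-ring

recipℕ-inverseˡ : ∀ m → recipℕ (suc m) * ℕ→ℚ (suc m) ≡ 1ℚ
recipℕ-inverseˡ m rewrite ℕ→ℚ≡mkℚ (suc m) =
  trans (cong (_* q) (normalize-coprime (Coprimality.1-coprimeTo (suc m)))) (*-inverseˡ q)
  where q = mkℚ (ℤ.+ suc m) 0 (Coprimality.sym (Coprimality.1-coprimeTo (suc m)))

recipℕ-inverseʳ : ∀ m → ℕ→ℚ (suc m) * recipℕ (suc m) ≡ 1ℚ
recipℕ-inverseʳ m = trans (*-comm (ℕ→ℚ (suc m)) (recipℕ (suc m))) (recipℕ-inverseˡ m)

ℕ→ℚ-suc-*-cancelˡ : ∀ m x y → ℕ→ℚ (suc m) * x ≡ ℕ→ℚ (suc m) * y → x ≡ y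
ℕ→ℚ-suc-*-cancelˡ m x y eq = trans (divide x refl) (sym (divide y (sym eq)))
  where
  divide : ∀ z → ℕ→ℚ (suc m) * z ≡ ℕ→ℚ (suc m) * x → z ≡ recipℕ (suc m) * (ℕ→ℚ (suc m) * x)
  divide z e = begin
    z                                          ≡⟨ sym (*-identityˡ z) ⟩
    1ℚ * z                                     ≡⟨ cong (_* z) (sym (recipℕ-inverseˡ m)) ⟩
    (recipℕ (suc m) * ℕ→ℚ (suc m)) * z         ≡⟨ *-assoc (recipℕ (suc m)) _ z ⟩
    recipℕ (suc m) * (ℕ→ℚ (suc m) * z)         ≡⟨ cong (recipℕ (suc m) *_) e ⟩
    recipℕ (suc m) * (ℕ→ℚ (suc m) * x)         ∎

ℕ→ℚ-suc≢0 : ∀ m → ℕ→ℚ (suc m) ≢ 0ℚ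
ℕ→ℚ-suc≢0 m e with trans (sym (recipℕ-inverseˡ m))
                         (trans (cong (recipℕ (suc m) *_) e) (*-zeroʳ (recipℕ (suc m))))
... | ()

zero-product : ∀ a b → a * b ≡ 0ℚ → a ≡ 0ℚ ⊎ b ≡ 0ℚ
zero-product a b ab≡0 with a ≟ 0ℚ
... | yes a≡0 = inj₁ a≡0
... | no  a≢0 = inj₂ (begin
  b                  ≡⟨ sym (*-identityˡ b) ⟩
  1ℚ * b             ≡⟨ cong (_* b) (sym (*-inverseˡ a)) ⟩
  (a⁻¹ * a) * b      ≡⟨ *-assoc a⁻¹ a b ⟩
  a⁻¹ * (a * b)      ≡⟨ cong (a⁻¹ *_) ab≡0 ⟩
  a⁻¹ * 0ℚ           ≡⟨ *-zeroʳ a⁻¹ ⟩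
  0ℚ                 ∎)
  where
  instance _ = ℚ.≢-nonZero a≢0
  a⁻¹ = ℚ.1/ a

sgn-*-sgn : ∀ j → sgn j * sgn j ≡ 1ℚ
sgn-*-sgn zero    = refl
sgn-*-sgn (suc j) = trans (neg-*-neg (sgn j)) (sgn-*-sgn j)
  where
  neg-*-neg : ∀ x → (- x) * (- x) ≡ x * x
  neg-*-neg = solve-∀ ℚ-ring

invFact-*-! : ∀ n → invFact n * ℕ→ℚ (n !) ≡ 1ℚ
invFact-*-! zero    = refl
invFact-*-! (suc n) = begin
  (invFact n * recipℕ (suc n)) * ℕ→ℚ (suc n *ℕ n !)
    ≡⟨ cong ((invFact n * recipℕ (suc n)) *_) (ℕ→ℚ-* (suc n) (n !)) ⟩
  (invFact n * recipℕ (suc n)) * (ℕ→ℚ (suc n) * ℕ→ℚ (n !))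
    ≡⟨ regroup (invFact n) (recipℕ (suc n)) (ℕ→ℚ (suc n)) (ℕ→ℚ (n !)) ⟩
  (recipℕ (suc n) * ℕ→ℚ (suc n)) * (invFact n * ℕ→ℚ (n !))
    ≡⟨ cong₂ _*_ (recipℕ-inverseˡ n) (invFact-*-! n) ⟩
  1ℚ ∎
  where
  regroup : ∀ a b c d → (a * b) * (c * d) ≡ (b * c) * (a * d)
  regroup = solve-∀ ℚ-ring

Σ≤-cong : ∀ n {f g : ℕ → ℚ} → (∀ i → i ≤ n → f i ≡ g i) → Σ≤ n f ≡ Σ≤ n g
Σ≤-cong zero    f≗g = f≗g 0 z≤n
Σ≤-cong (suc n) f≗g = cong₂ _+_ (Σ≤-cong n (λ i i≤n → f≗g i (ℕP.m≤n⇒m≤1+n i≤n)))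
                               (f≗g (suc n) ℕP.≤-refl)

Σ≤-cong′ : ∀ n {f g : ℕ → ℚ} → (∀ i → f i ≡ g i) → Σ≤ n f ≡ Σ≤ n g
Σ≤-cong′ n f≗g = Σ≤-cong n (λ i _ → f≗g i)

Σ≤-distrib-+ : ∀ n (f g : ℕ → ℚ) → Σ≤ n (λ i → f i + g i) ≡ Σ≤ n f + Σ≤ n g
Σ≤-distrib-+ zero    f g = refl
Σ≤-distrib-+ (suc n) f g =
  trans (cong (_+ (f (suc n) + g (suc n))) (Σ≤-distrib-+ n f g))
        (interchange (Σ≤ n f) (Σ≤ n g) (f (suc n)) (g (suc n)))
  where
  interchange : ∀ a b c d → (a + b) + (c + d) ≡ (a + c) + (b + d)
  interchange = solve-∀ ℚ-ring

Σ≤-*ˡ : ∀ n c (f : ℕ → ℚ) → c * Σ≤ n f ≡ Σ≤ n (λ i → c * f i)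
Σ≤-*ˡ zero    c f = refl
Σ≤-*ˡ (suc n) c f =
  trans (*-distribˡ-+ c (Σ≤ n f) (f (suc n))) (cong (_+ c * f (suc n)) (Σ≤-*ˡ n c f))

Σ≤-zero : ∀ n → Σ≤ n (λ _ → 0ℚ) ≡ 0ℚ
Σ≤-zero zero    = refl
Σ≤-zero (suc n) = trans (+-identityʳ (Σ≤ n (λ _ → 0ℚ))) (Σ≤-zero n)

Σ≤-suc : ∀ n (f : ℕ → ℚ) → Σ≤ (suc n) f ≡ f 0 + Σ≤ n (λ i → f (suc i))
Σ≤-suc zero    f = refl
Σ≤-suc (suc n) f = trans (cong (_+ f (suc (suc n))) (Σ≤-suc n f))
                         (+-assoc (f 0) (Σ≤ n (λ i → f (suc i))) (f (suc (suc n))))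

Σ≤-head : ∀ n (f : ℕ → ℚ) → (∀ i → f (suc i) ≡ 0ℚ) → Σ≤ n f ≡ f 0
Σ≤-head zero    f tail≡0 = refl
Σ≤-head (suc n) f tail≡0 = begin
  Σ≤ (suc n) f                       ≡⟨ Σ≤-suc n f ⟩
  f 0 + Σ≤ n (λ i → f (suc i))       ≡⟨ cong (f 0 +_) (trans (Σ≤-cong′ n tail≡0) (Σ≤-zero n)) ⟩
  f 0 + 0ℚ                           ≡⟨ +-identityʳ (f 0) ⟩
  f 0                                ∎

Σ≤-single : ∀ n k (f : ℕ → ℚ) → k ≤ n → (∀ i → i ≢ k → f i ≡ 0ℚ) → Σ≤ n f ≡ f k
Σ≤-single zero    .zero f z≤n others≡0 = refl
Σ≤-single (suc n) k     f k≤n others≡0 with k ℕ.≟ suc n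
... | yes refl = trans (cong (_+ f (suc n)) (trans (Σ≤-cong n below≡0) (Σ≤-zero n)))
                       (+-identityˡ (f (suc n)))
  where
  below≡0 : ∀ i → i ≤ n → f i ≡ 0ℚ
  below≡0 i i≤n = others≡0 i (λ { refl → ℕP.<-irrefl refl (s≤s i≤n) })
... | no  k≢ = trans (cong₂ _+_ (Σ≤-single n k f (ℕP.≤-pred (ℕP.≤∧≢⇒< k≤n k≢)) others≡0)
                                (others≡0 (suc n) (λ e → k≢ (sym e))))
                     (+-identityʳ (f k))

Σ≤-pad : ∀ n M (f : ℕ → ℚ) → n ≤ M → (∀ k → n < k → f k ≡ 0ℚ) → Σ≤ M f ≡ Σ≤ n f
Σ≤-pad n M f n≤M beyond≡0 =
  trans (cong (λ m → Σ≤ m f) (sym (ℕP.m+[n∸m]≡n n≤M))) (pad (M ∸ n))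
  where
  pad : ∀ d → Σ≤ (n +ℕ d) f ≡ Σ≤ n f
  pad zero    = cong (λ m → Σ≤ m f) (ℕP.+-identityʳ n)
  pad (suc d) = begin
    Σ≤ (n +ℕ suc d) f                   ≡⟨ cong (λ m → Σ≤ m f) (ℕP.+-suc n d) ⟩
    Σ≤ (n +ℕ d) f + f (suc (n +ℕ d))    ≡⟨ cong₂ _+_ (pad d) (beyond≡0 _ (s≤s (ℕP.m≤m+n n d))) ⟩
    Σ≤ n f + 0ℚ                         ≡⟨ +-identityʳ (Σ≤ n f) ⟩
    Σ≤ n f                              ∎

Σ≤-swap : ∀ n m (F : ℕ → ℕ → ℚ) →
          Σ≤ n (λ i → Σ≤ m (λ k → F i k)) ≡ Σ≤ m (λ k → Σ≤ n (λ i → F i k))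
Σ≤-swap zero    m F = refl
Σ≤-swap (suc n) m F =
  trans (cong (_+ Σ≤ m (λ k → F (suc n) k)) (Σ≤-swap n m F))
        (sym (Σ≤-distrib-+ m (λ k → Σ≤ n (λ i → F i k)) (λ k → F (suc n) k)))

Π≤-zero : ∀ n k (f : ℕ → ℚ) → k ≤ n → f k ≡ 0ℚ → Π≤ n f ≡ 0ℚ
Π≤-zero zero    .zero f z≤n fk≡0 = fk≡0
Π≤-zero (suc n) k     f k≤n fk≡0 with k ℕ.≟ suc n
... | yes refl = trans (cong (Π≤ n f *_) fk≡0) (*-zeroʳ (Π≤ n f))
... | no  k≢   = trans (cong (_* f (suc n)) (Π≤-zero n k f (ℕP.≤-pred (ℕP.≤∧≢⇒< k≤n k≢)) fk≡0))
                       (*-zeroˡ (f (suc n)))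

-- Formal power series

infix 4 _≈_
_≈_ : Series → Series → Set
f ≈ g = ∀ n → f n ≡ g n

≈-refl : ∀ {f} → f ≈ f
≈-refl n = refl

≈-sym : ∀ {f g} → f ≈ g → g ≈ f
≈-sym f≈g n = sym (f≈g n)

≈-trans : ∀ {f g h} → f ≈ g → g ≈ h → f ≈ h
≈-trans f≈g g≈h n = trans (f≈g n) (g≈h n)

infixr 2 _≈⟨_⟩_
infix  3 _∎ₛ
_≈⟨_⟩_ : ∀ f {g h} → f ≈ g → g ≈ h → f ≈ h
f ≈⟨ f≈g ⟩ g≈h = ≈-trans f≈g g≈h

_∎ₛ : ∀ f → f ≈ f
f ∎ₛ = ≈-refl

zeroS : Series
zeroS _ = 0ℚ

negS : Series → Series
negS f n = - f n

constS : ℚ → Series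
constS c zero    = c
constS c (suc n) = 0ℚ

tailS : Series → Series
tailS f n = f (suc n)

X : Series
X zero          = 0ℚ
X (suc zero)    = 1ℚ
X (suc (suc n)) = 0ℚ

⊗-suc : ∀ f g n → (f ⊗ g) (suc n) ≡ f 0 * g (suc n) + (tailS f ⊗ g) n
⊗-suc f g n = Σ≤-suc n (λ i → f i * g (suc n ∸ i))

⊗-cong : ∀ {f f′ g g′} → f ≈ f′ → g ≈ g′ → f ⊗ g ≈ f′ ⊗ g′
⊗-cong f≈f′ g≈g′ n = Σ≤-cong′ n (λ i → cong₂ _*_ (f≈f′ i) (g≈g′ (n ∸ i)))

⊕-cong : ∀ {f f′ g g′} → f ≈ f′ → g ≈ g′ → f ⊕ g ≈ f′ ⊕ g′
⊕-cong f≈f′ g≈g′ n = cong₂ _+_ (f≈f′ n) (g≈g′ n)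

negS-cong : ∀ {f f′} → f ≈ f′ → negS f ≈ negS f′
negS-cong f≈f′ n = cong -_ (f≈f′ n)

⊗-distribˡ : ∀ f g h → f ⊗ (g ⊕ h) ≈ (f ⊗ g) ⊕ (f ⊗ h)
⊗-distribˡ f g h n =
  trans (Σ≤-cong′ n (λ i → *-distribˡ-+ (f i) (g (n ∸ i)) (h (n ∸ i)))) (Σ≤-distrib-+ n _ _)

⊗-distribʳ : ∀ f g h → (g ⊕ h) ⊗ f ≈ (g ⊗ f) ⊕ (h ⊗ f)
⊗-distribʳ f g h n =
  trans (Σ≤-cong′ n (λ i → *-distribʳ-+ (f (n ∸ i)) (g i) (h i))) (Σ≤-distrib-+ n _ _)

⊗-scaleˡ : ∀ c f g → scale c f ⊗ g ≈ scale c (f ⊗ g)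
⊗-scaleˡ c f g n = trans (Σ≤-cong′ n (λ i → *-assoc c (f i) (g (n ∸ i)))) (sym (Σ≤-*ˡ n c _))

⊗-zeroˡ : ∀ g → zeroS ⊗ g ≈ zeroS
⊗-zeroˡ g n = trans (Σ≤-cong′ n (λ i → *-zeroˡ (g (n ∸ i)))) (Σ≤-zero n)

⊗-identityˡ : ∀ f → oneS ⊗ f ≈ f
⊗-identityˡ f zero    = *-identityˡ (f 0)
⊗-identityˡ f (suc n) = trans (⊗-suc oneS f n)
  (trans (cong₂ _+_ (*-identityˡ (f (suc n))) (⊗-zeroˡ f n)) (+-identityʳ (f (suc n))))

tailS-⊗ : ∀ f g → tailS (f ⊗ g) ≈ scale (f 0) (tailS g) ⊕ (tailS f ⊗ g)
tailS-⊗ f g n = ⊗-suc f g n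

⊗-assoc : ∀ f g h → (f ⊗ g) ⊗ h ≈ f ⊗ (g ⊗ h)
⊗-assoc f g h zero    = *-assoc (f 0) (g 0) (h 0)
⊗-assoc f g h (suc n) = begin
  ((f ⊗ g) ⊗ h) (suc n)
    ≡⟨ ⊗-suc (f ⊗ g) h n ⟩
  (f 0 * g 0) * h (suc n) + (tailS (f ⊗ g) ⊗ h) n
    ≡⟨ cong ((f 0 * g 0) * h (suc n) +_) tail-assoc ⟩
  (f 0 * g 0) * h (suc n) + (f 0 * (tailS g ⊗ h) n + (tailS f ⊗ (g ⊗ h)) n)
    ≡⟨ regroup (f 0) (g 0) (h (suc n)) ((tailS g ⊗ h) n) ((tailS f ⊗ (g ⊗ h)) n) ⟩
  f 0 * (g 0 * h (suc n) + (tailS g ⊗ h) n) + (tailS f ⊗ (g ⊗ h)) n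
    ≡⟨ cong (λ z → f 0 * z + (tailS f ⊗ (g ⊗ h)) n) (sym (⊗-suc g h n)) ⟩
  f 0 * (g ⊗ h) (suc n) + (tailS f ⊗ (g ⊗ h)) n
    ≡⟨ sym (⊗-suc f (g ⊗ h) n) ⟩
  (f ⊗ (g ⊗ h)) (suc n) ∎
  where
  regroup : ∀ a b c d e → (a * b) * c + (a * d + e) ≡ a * (b * c + d) + e
  regroup = solve-∀ ℚ-ring
  tail-assoc : (tailS (f ⊗ g) ⊗ h) n ≡ f 0 * (tailS g ⊗ h) n + (tailS f ⊗ (g ⊗ h)) n
  tail-assoc = begin
    (tailS (f ⊗ g) ⊗ h) n
      ≡⟨ ⊗-cong (tailS-⊗ f g) (≈-refl {h}) n ⟩
    ((scale (f 0) (tailS g) ⊕ (tailS f ⊗ g)) ⊗ h) n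
      ≡⟨ ⊗-distribʳ h (scale (f 0) (tailS g)) (tailS f ⊗ g) n ⟩
    (scale (f 0) (tailS g) ⊗ h) n + ((tailS f ⊗ g) ⊗ h) n
      ≡⟨ cong₂ _+_ (⊗-scaleˡ (f 0) (tailS g) h n) (⊗-assoc (tailS f) g h n) ⟩
    f 0 * (tailS g ⊗ h) n + (tailS f ⊗ (g ⊗ h)) n ∎

⊗-comm : ∀ f g → f ⊗ g ≈ g ⊗ f
⊗-comm f g zero          = *-comm (f 0) (g 0)
⊗-comm f g (suc zero)    = begin
  (f ⊗ g) 1               ≡⟨ ⊗-suc f g 0 ⟩
  f 0 * g 1 + f 1 * g 0   ≡⟨ swap (f 0) (g 1) (f 1) (g 0) ⟩
  g 0 * f 1 + g 1 * f 0   ≡⟨ sym (⊗-suc g f 0) ⟩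
  (g ⊗ f) 1               ∎
  where
  swap : ∀ a b c d → a * b + c * d ≡ d * c + b * a
  swap = solve-∀ ℚ-ring
⊗-comm f g (suc (suc n)) = begin
  (f ⊗ g) (suc (suc n))
    ≡⟨ ⊗-suc f g (suc n) ⟩
  f 0 * g₂ + (tailS f ⊗ g) (suc n)
    ≡⟨ cong (f 0 * g₂ +_) (trans (⊗-comm (tailS f) g (suc n)) (⊗-suc g (tailS f) n)) ⟩
  f 0 * g₂ + (g 0 * f₂ + (tailS g ⊗ tailS f) n)
    ≡⟨ cong (λ z → f 0 * g₂ + (g 0 * f₂ + z)) (⊗-comm (tailS g) (tailS f) n) ⟩
  f 0 * g₂ + (g 0 * f₂ + (tailS f ⊗ tailS g) n)
    ≡⟨ exchange (f 0 * g₂) (g 0 * f₂) ((tailS f ⊗ tailS g) n) ⟩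
  g 0 * f₂ + (f 0 * g₂ + (tailS f ⊗ tailS g) n)
    ≡⟨ cong (g 0 * f₂ +_) (sym (trans (⊗-comm (tailS g) f (suc n)) (⊗-suc f (tailS g) n))) ⟩
  g 0 * f₂ + (tailS g ⊗ f) (suc n)
    ≡⟨ sym (⊗-suc g f (suc n)) ⟩
  (g ⊗ f) (suc (suc n)) ∎
  where
  f₂ = f (suc (suc n))
  g₂ = g (suc (suc n))
  exchange : ∀ a b c → a + (b + c) ≡ b + (a + c)
  exchange = solve-∀ ℚ-ring

⊗-identityʳ : ∀ f → f ⊗ oneS ≈ f
⊗-identityʳ f = ≈-trans (⊗-comm f oneS) (⊗-identityˡ f)

series-isCommutativeRing : IsCommutativeRing _≈_ _⊕_ _⊗_ negS zeroS oneS
series-isCommutativeRing = record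
  { isRing = record
    { +-isAbelianGroup = record
      { isGroup = record
        { isMonoid = record
          { isSemigroup = record
            { isMagma = record { isEquivalence = ≈-isEquivalence ; ∙-cong = ⊕-cong }
            ; assoc = λ f g h n → +-assoc (f n) (g n) (h n) }
          ; identity = (λ f n → +-identityˡ (f n)) , (λ f n → +-identityʳ (f n)) }
        ; inverse = (λ f n → +-inverseˡ (f n)) , (λ f n → +-inverseʳ (f n))
        ; ⁻¹-cong = negS-cong }
      ; comm = λ f g n → +-comm (f n) (g n) }
    ; *-cong = ⊗-cong
    ; *-assoc = ⊗-assoc
    ; *-identity = ⊗-identityˡ , ⊗-identityʳ
    ; distrib = ⊗-distribˡ , ⊗-distribʳ }
  ; *-comm = ⊗-comm }
  where
  ≈-isEquivalence : IsEquivalence _≈_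
  ≈-isEquivalence = record { refl = λ {f} → ≈-refl {f} ; sym = ≈-sym ; trans = ≈-trans }

seriesRing : CommutativeRing _ _
seriesRing = record { isCommutativeRing = series-isCommutativeRing }

constS-+ : ∀ a b → constS (a + b) ≈ constS a ⊕ constS b
constS-+ a b zero    = refl
constS-+ a b (suc n) = refl

constS-* : ∀ a b → constS (a * b) ≈ constS a ⊗ constS b
constS-* a b zero    = refl
constS-* a b (suc n) = sym (begin
  (constS a ⊗ constS b) (suc n)             ≡⟨ ⊗-suc (constS a) (constS b) n ⟩
  a * 0ℚ + (zeroS ⊗ constS b) n             ≡⟨ cong₂ _+_ (*-zeroʳ a) (⊗-zeroˡ (constS b) n) ⟩
  0ℚ + 0ℚ                                   ≡⟨ +-identityʳ 0ℚ ⟩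
  0ℚ                                        ∎)

constS-morphism : ACR._-Raw-AlmostCommutative⟶_ +-*-rawRing (ACR.fromCommutativeRing seriesRing)
constS-morphism = record
  { ⟦_⟧    = constS
  ; +-homo = constS-+
  ; *-homo = constS-*
  ; -‿homo = λ { a zero → refl ; a (suc n) → refl }
  ; 0-homo = λ { zero → refl ; (suc n) → refl }
  ; 1-homo = λ { zero → refl ; (suc n) → refl } }

constS-≟ : ∀ a b → Maybe (constS a ≈ constS b)
constS-≟ a b with a ≟ b
... | yes refl = just ≈-refl
... | no  _    = nothing

module SeriesSolver = RingSolver +-*-rawRing (ACR.fromCommutativeRing seriesRing) constS-morphism constS-≟

oneS≈constS1 : oneS ≈ constS 1ℚ
oneS≈constS1 zero    = refl
oneS≈constS1 (suc n) = refl

constS-⊗ : ∀ c f → constS c ⊗ f ≈ scale c f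
constS-⊗ c f zero    = refl
constS-⊗ c f (suc n) = begin
  (constS c ⊗ f) (suc n)                 ≡⟨ ⊗-suc (constS c) f n ⟩
  c * f (suc n) + (zeroS ⊗ f) n          ≡⟨ cong (c * f (suc n) +_) (⊗-zeroˡ f n) ⟩
  c * f (suc n) + 0ℚ                     ≡⟨ +-identityʳ (c * f (suc n)) ⟩
  c * f (suc n)                          ∎

X-⊗-zero : ∀ f → (X ⊗ f) 0 ≡ 0ℚ
X-⊗-zero f = *-zeroˡ (f 0)

X-⊗-suc : ∀ f n → (X ⊗ f) (suc n) ≡ f n
X-⊗-suc f n = begin
  (X ⊗ f) (suc n)                  ≡⟨ ⊗-suc X f n ⟩
  0ℚ * f (suc n) + (tailS X ⊗ f) n ≡⟨ cong₂ _+_ (*-zeroˡ (f (suc n))) (⊗-cong tailX≈1 (≈-refl {f}) n) ⟩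
  0ℚ + (oneS ⊗ f) n                ≡⟨ +-identityˡ _ ⟩
  (oneS ⊗ f) n                     ≡⟨ ⊗-identityˡ f n ⟩
  f n                              ∎
  where
  tailX≈1 : tailS X ≈ oneS
  tailX≈1 zero    = refl
  tailX≈1 (suc k) = refl

constS-⊗-X-⊗ : ∀ c f k → (constS c ⊗ (X ⊗ f)) (suc k) ≡ c * f k
constS-⊗-X-⊗ c f k = trans (constS-⊗ c (X ⊗ f) (suc k)) (cong (c *_) (X-⊗-suc f k))

X^S-⊗-shift : ∀ m f n → ((X ^S m) ⊗ f) (n +ℕ m) ≡ f n
X^S-⊗-shift zero    f n = trans (⊗-identityˡ f (n +ℕ 0)) (cong f (ℕP.+-identityʳ n))
X^S-⊗-shift (suc m) f n = begin
  (((X ^S m) ⊗ X) ⊗ f) (n +ℕ suc m) ≡⟨ ⊗-assoc (X ^S m) X f (n +ℕ suc m) ⟩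
  ((X ^S m) ⊗ (X ⊗ f)) (n +ℕ suc m) ≡⟨ cong ((X ^S m) ⊗ (X ⊗ f)) (ℕP.+-suc n m) ⟩
  ((X ^S m) ⊗ (X ⊗ f)) (suc n +ℕ m) ≡⟨ X^S-⊗-shift m (X ⊗ f) (suc n) ⟩
  (X ⊗ f) (suc n)                   ≡⟨ X-⊗-suc f n ⟩
  f n                               ∎

^S-cong : ∀ {f g} m → f ≈ g → f ^S m ≈ g ^S m
^S-cong zero    f≈g = ≈-refl
^S-cong (suc m) f≈g = ⊗-cong (^S-cong m f≈g) f≈g

^S-zero : ∀ f m → (f ^S m) 0 ≡ f 0 ^Q m
^S-zero f zero    = refl
^S-zero f (suc m) = cong (_* f 0) (^S-zero f m)

^S-distrib-⊗ : ∀ m f g → (f ⊗ g) ^S m ≈ (f ^S m) ⊗ (g ^S m)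
^S-distrib-⊗ zero    f g = ≈-sym (⊗-identityˡ oneS)
^S-distrib-⊗ (suc m) f g =
  ≈-trans (⊗-cong (^S-distrib-⊗ m f g) (≈-refl {f ⊗ g})) (interchange (f ^S m) (g ^S m) f g)
  where
  open SeriesSolver
  interchange : ∀ a b c d → (a ⊗ b) ⊗ (c ⊗ d) ≈ (a ⊗ c) ⊗ (b ⊗ d)
  interchange = solve 4 (λ a b c d → (a :* b) :* (c :* d) := (a :* c) :* (b :* d)) ≈-refl

VanishesBelow : ℕ → Series → Set
VanishesBelow m f = ∀ k → k < m → f k ≡ 0ℚ

VanishesBelow-⊗ : ∀ a b f g → VanishesBelow a f → VanishesBelow b g → VanishesBelow (a +ℕ b) (f ⊗ g)
VanishesBelow-⊗ a b f g f<a≡0 g<b≡0 k k<a+b = trans (Σ≤-cong k term≡0) (Σ≤-zero k)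
  where
  term≡0 : ∀ i → i ≤ k → f i * g (k ∸ i) ≡ 0ℚ
  term≡0 i i≤k with i ℕ.<? a
  ... | yes i<a = trans (cong (_* g (k ∸ i)) (f<a≡0 i i<a)) (*-zeroˡ (g (k ∸ i)))
  ... | no  i≮a = trans (cong (f i *_) (g<b≡0 (k ∸ i) k∸i<b)) (*-zeroʳ (f i))
    where
    k∸i<b : k ∸ i < b
    k∸i<b = ℕP.+-cancelˡ-< i (k ∸ i) b
      (ℕP.≤-trans (s≤s (ℕP.≤-reflexive (ℕP.m+[n∸m]≡n i≤k)))
                  (ℕP.≤-trans k<a+b (ℕP.+-monoˡ-≤ b (ℕP.≮⇒≥ i≮a))))

VanishesBelow-^S : ∀ h → h 0 ≡ 0ℚ → ∀ m → VanishesBelow m (h ^S m)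
VanishesBelow-^S h h0≡0 zero    k ()
VanishesBelow-^S h h0≡0 (suc m) k k<1+m =
  VanishesBelow-⊗ m 1 (h ^S m) h (VanishesBelow-^S h h0≡0 m) h<1≡0 k
                  (ℕP.≤-trans k<1+m (ℕP.≤-reflexive (ℕP.+-comm 1 m)))
  where
  h<1≡0 : VanishesBelow 1 h
  h<1≡0 zero    _             = h0≡0
  h<1≡0 (suc k) (s≤s ())

θ : Series → Series
θ f n = ℕ→ℚ n * f n

θ-cong : ∀ {f g} → f ≈ g → θ f ≈ θ g
θ-cong f≈g n = cong (ℕ→ℚ n *_) (f≈g n)

θ-oneS : θ oneS ≈ constS 0ℚ
θ-oneS zero    = refl
θ-oneS (suc n) = *-zeroʳ (ℕ→ℚ (suc n))

θ-⊗ : ∀ f g → θ (f ⊗ g) ≈ (θ f ⊗ g) ⊕ (f ⊗ θ g)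
θ-⊗ f g n = begin
  ℕ→ℚ n * Σ≤ n (λ i → f i * g (n ∸ i))
    ≡⟨ Σ≤-*ˡ n (ℕ→ℚ n) _ ⟩
  Σ≤ n (λ i → ℕ→ℚ n * (f i * g (n ∸ i)))
    ≡⟨ Σ≤-cong n leibniz ⟩
  Σ≤ n (λ i → (ℕ→ℚ i * f i) * g (n ∸ i) + f i * (ℕ→ℚ (n ∸ i) * g (n ∸ i)))
    ≡⟨ Σ≤-distrib-+ n _ _ ⟩
  ((θ f ⊗ g) ⊕ (f ⊗ θ g)) n ∎
  where
  distribute : ∀ a b x y → (a + b) * (x * y) ≡ (a * x) * y + x * (b * y)
  distribute = solve-∀ ℚ-ring
  leibniz : ∀ i → i ≤ n → ℕ→ℚ n * (f i * g (n ∸ i))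
                        ≡ (ℕ→ℚ i * f i) * g (n ∸ i) + f i * (ℕ→ℚ (n ∸ i) * g (n ∸ i))
  leibniz i i≤n =
    trans (cong (_* (f i * g (n ∸ i)))
                (trans (cong ℕ→ℚ (sym (ℕP.m+[n∸m]≡n i≤n))) (ℕ→ℚ-+ i (n ∸ i))))
          (distribute (ℕ→ℚ i) (ℕ→ℚ (n ∸ i)) (f i) (g (n ∸ i)))

θ-^S : ∀ f m → θ (f ^S suc m) ≈ constS (ℕ→ℚ (suc m)) ⊗ ((f ^S m) ⊗ θ f)
θ-^S f zero =
  θ (oneS ⊗ f)                       ≈⟨ θ-cong (⊗-identityˡ f) ⟩
  θ f                                ≈⟨ unit (θ f) ⟩
  constS 1ℚ ⊗ (constS 1ℚ ⊗ θ f)      ≈⟨ ⊗-cong (≈-refl {constS 1ℚ})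
                                                (⊗-cong (≈-sym oneS≈constS1) (≈-refl {θ f})) ⟩
  constS 1ℚ ⊗ (oneS ⊗ θ f)           ∎ₛ
  where
  open SeriesSolver
  unit : ∀ x → x ≈ constS 1ℚ ⊗ (constS 1ℚ ⊗ x)
  unit = solve 1 (λ x → x := con 1ℚ :* (con 1ℚ :* x)) ≈-refl
θ-^S f (suc m) =
  θ ((f ^S suc m) ⊗ f)
    ≈⟨ θ-⊗ (f ^S suc m) f ⟩
  (θ (f ^S suc m) ⊗ f) ⊕ ((f ^S suc m) ⊗ θ f)
    ≈⟨ ⊕-cong (⊗-cong (θ-^S f m) (≈-refl {f})) (≈-refl {(f ^S suc m) ⊗ θ f}) ⟩
  ((c ⊗ ((f ^S m) ⊗ θ f)) ⊗ f) ⊕ (((f ^S m) ⊗ f) ⊗ θ f)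
    ≈⟨ collect c (f ^S m) f (θ f) ⟩
  (constS 1ℚ ⊕ c) ⊗ (((f ^S m) ⊗ f) ⊗ θ f)
    ≈⟨ ⊗-cong (≈-sym 1+c≈) (≈-refl {((f ^S m) ⊗ f) ⊗ θ f}) ⟩
  constS (ℕ→ℚ (suc (suc m))) ⊗ (((f ^S m) ⊗ f) ⊗ θ f) ∎ₛ
  where
  open SeriesSolver
  c = constS (ℕ→ℚ (suc m))
  collect : ∀ c p f d → ((c ⊗ (p ⊗ d)) ⊗ f) ⊕ ((p ⊗ f) ⊗ d) ≈ (constS 1ℚ ⊕ c) ⊗ ((p ⊗ f) ⊗ d)
  collect = solve 4 (λ c p f d → ((c :* (p :* d)) :* f) :+ ((p :* f) :* d)
                                 := (con 1ℚ :+ c) :* ((p :* f) :* d)) ≈-refl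
  1+c≈ : constS (ℕ→ℚ (suc (suc m))) ≈ constS 1ℚ ⊕ c
  1+c≈ = ≈-trans (λ n → cong (λ z → constS z n) (ℕ→ℚ-suc (suc m))) (constS-+ 1ℚ (ℕ→ℚ (suc m)))

-- Rational powers of series

binom-suc : ∀ x k → ℕ→ℚ (suc k) * binom x (suc k) ≡ binom x k * (x - ℕ→ℚ k)
binom-suc x k = begin
  ℕ→ℚ (suc k) * (b * recipℕ (suc k))    ≡⟨ exchange (ℕ→ℚ (suc k)) b (recipℕ (suc k)) ⟩
  b * (ℕ→ℚ (suc k) * recipℕ (suc k))    ≡⟨ cong (b *_) (recipℕ-inverseʳ k) ⟩
  b * 1ℚ                                ≡⟨ *-identityʳ b ⟩
  b                                     ∎
  where
  b = binom x k * (x - ℕ→ℚ k)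
  exchange : ∀ a b c → a * (b * c) ≡ b * (a * c)
  exchange = solve-∀ ℚ-ring

binom-pascal : ∀ x k → binom (x + 1ℚ) (suc k) ≡ binom x (suc k) + binom x k
binom-pascal x zero = first-order x
  where
  first-order : ∀ x → 1ℚ * ((x + 1ℚ) - 0ℚ) * 1ℚ ≡ 1ℚ * (x - 0ℚ) * 1ℚ + 1ℚ
  first-order = solve-∀ ℚ-ring
binom-pascal x (suc k) = ℕ→ℚ-suc-*-cancelˡ (suc k) _ _ (begin
  ℕ→ℚ (suc (suc k)) * binom (x + 1ℚ) (suc (suc k))
    ≡⟨ binom-suc (x + 1ℚ) (suc k) ⟩
  binom (x + 1ℚ) (suc k) * ((x + 1ℚ) - ℕ→ℚ (suc k))
    ≡⟨ cong₂ (λ u v → u * ((x + 1ℚ) - v)) (binom-pascal x k) (ℕ→ℚ-suc k) ⟩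
  (B₁ + B₀) * ((x + 1ℚ) - (1ℚ + κ))
    ≡⟨ expand x κ B₁ B₀ ⟩
  B₁ * (x - (1ℚ + κ)) + ((1ℚ + (1ℚ + κ)) * B₁ + (B₀ * (x - κ) - (1ℚ + κ) * B₁))
    ≡⟨ cong (λ z → B₁ * (x - (1ℚ + κ)) + ((1ℚ + (1ℚ + κ)) * B₁ + z)) recurrence ⟩
  B₁ * (x - (1ℚ + κ)) + ((1ℚ + (1ℚ + κ)) * B₁ + 0ℚ)
    ≡⟨ cong₂ (λ u v → B₁ * (x - u) + (v * B₁ + 0ℚ)) (sym (ℕ→ℚ-suc k)) 2+κ≡ ⟩
  B₁ * (x - ℕ→ℚ (suc k)) + (ℕ→ℚ (suc (suc k)) * B₁ + 0ℚ)
    ≡⟨ cong₂ _+_ (sym (binom-suc x (suc k))) (+-identityʳ _) ⟩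
  ℕ→ℚ (suc (suc k)) * binom x (suc (suc k)) + ℕ→ℚ (suc (suc k)) * B₁
    ≡⟨ sym (*-distribˡ-+ (ℕ→ℚ (suc (suc k))) _ _) ⟩
  ℕ→ℚ (suc (suc k)) * (binom x (suc (suc k)) + B₁) ∎)
  where
  B₁ = binom x (suc k)
  B₀ = binom x k
  κ  = ℕ→ℚ k
  expand : ∀ x κ B₁ B₀ → (B₁ + B₀) * ((x + 1ℚ) - (1ℚ + κ))
           ≡ B₁ * (x - (1ℚ + κ)) + ((1ℚ + (1ℚ + κ)) * B₁ + (B₀ * (x - κ) - (1ℚ + κ) * B₁))
  expand = solve-∀ ℚ-ring
  recurrence : B₀ * (x - κ) - (1ℚ + κ) * B₁ ≡ 0ℚ
  recurrence = trans (cong (λ z → B₀ * (x - κ) - z)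
                           (trans (cong (_* B₁) (sym (ℕ→ℚ-suc k))) (binom-suc x k)))
                     (+-inverseʳ (B₀ * (x - κ)))
  2+κ≡ : 1ℚ + (1ℚ + κ) ≡ ℕ→ℚ (suc (suc k))
  2+κ≡ = trans (cong (1ℚ +_) (sym (ℕ→ℚ-suc k))) (sym (ℕ→ℚ-suc (suc k)))

binom-zero-suc : ∀ k → binom 0ℚ (suc k) ≡ 0ℚ
binom-zero-suc zero    = refl
binom-zero-suc (suc k) = begin
  binom 0ℚ (suc k) * (0ℚ - ℕ→ℚ (suc k)) * recipℕ (suc (suc k))
    ≡⟨ cong (λ z → z * (0ℚ - ℕ→ℚ (suc k)) * recipℕ (suc (suc k))) (binom-zero-suc k) ⟩
  0ℚ * (0ℚ - ℕ→ℚ (suc k)) * recipℕ (suc (suc k))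
    ≡⟨ cong (_* recipℕ (suc (suc k))) (*-zeroˡ (0ℚ - ℕ→ℚ (suc k))) ⟩
  0ℚ * recipℕ (suc (suc k))
    ≡⟨ *-zeroˡ (recipℕ (suc (suc k))) ⟩
  0ℚ ∎

module _ (f : Series) (f0≡1 : f 0 ≡ 1ℚ) where

  private
    h : Series
    h = minus1 f

    h0≡0 : h 0 ≡ 0ℚ
    h0≡0 = trans (cong (_- 1ℚ) f0≡1) (+-inverseʳ 1ℚ)

  powS-pad : ∀ a n M → n ≤ M → Σ≤ M (λ k → binom a k * (h ^S k) n) ≡ powS f a n
  powS-pad a n M n≤M = Σ≤-pad n M _ n≤M (λ k n<k →
    trans (cong (binom a k *_) (VanishesBelow-^S h h0≡0 k n n<k)) (*-zeroʳ (binom a k)))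

  minus1-⊗-powS : ∀ a m → (h ⊗ powS f a) m ≡ Σ≤ m (λ k → binom a k * (h ^S suc k) m)
  minus1-⊗-powS a m = begin
    Σ≤ m (λ i → h i * powS f a (m ∸ i))
      ≡⟨ Σ≤-cong m (λ i i≤m → cong (h i *_) (sym (powS-pad a (m ∸ i) m (ℕP.m∸n≤m m i)))) ⟩
    Σ≤ m (λ i → h i * Σ≤ m (λ k → binom a k * (h ^S k) (m ∸ i)))
      ≡⟨ Σ≤-cong′ m (λ i → trans (Σ≤-*ˡ m (h i) _) (Σ≤-cong′ m (λ k → exchange (h i) (binom a k) _))) ⟩
    Σ≤ m (λ i → Σ≤ m (λ k → binom a k * (h i * (h ^S k) (m ∸ i))))
      ≡⟨ Σ≤-swap m m _ ⟩
    Σ≤ m (λ k → Σ≤ m (λ i → binom a k * (h i * (h ^S k) (m ∸ i))))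
      ≡⟨ Σ≤-cong′ m (λ k → sym (Σ≤-*ˡ m (binom a k) _)) ⟩
    Σ≤ m (λ k → binom a k * (h ⊗ (h ^S k)) m)
      ≡⟨ Σ≤-cong′ m (λ k → cong (binom a k *_) (⊗-comm h (h ^S k) m)) ⟩
    Σ≤ m (λ k → binom a k * (h ^S suc k) m) ∎
    where
    exchange : ∀ x y z → x * (y * z) ≡ y * (x * z)
    exchange = solve-∀ ℚ-ring

  powS-+1 : ∀ a → f ⊗ powS f a ≈ powS f (a + 1ℚ)
  powS-+1 a zero    = cong (_* (1ℚ * 1ℚ)) f0≡1
  powS-+1 a (suc n) = begin
    (f ⊗ powS f a) (suc n)
      ≡⟨ ⊗-cong f≈1+h (≈-refl {powS f a}) (suc n) ⟩
    ((oneS ⊕ h) ⊗ powS f a) (suc n)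
      ≡⟨ ⊗-distribʳ (powS f a) oneS h (suc n) ⟩
    (oneS ⊗ powS f a) (suc n) + (h ⊗ powS f a) (suc n)
      ≡⟨ cong₂ _+_ (⊗-identityˡ (powS f a) (suc n)) (minus1-⊗-powS a (suc n)) ⟩
    powS f a (suc n) + Σ≤ (suc n) (λ k → binom a k * H (suc k))
      ≡⟨ cong₂ _+_ (Σ≤-suc n _) refl ⟩
    (1ℚ * 0ℚ + A) + (B + binom a (suc n) * H (suc (suc n)))
      ≡⟨ cong (λ z → (1ℚ * 0ℚ + A) + (B + binom a (suc n) * z))
              (VanishesBelow-^S h h0≡0 (suc (suc n)) (suc n) ℕP.≤-refl) ⟩
    (1ℚ * 0ℚ + A) + (B + binom a (suc n) * 0ℚ)
      ≡⟨ regroup A B (binom a (suc n)) ⟩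
    1ℚ * 0ℚ + (A + B)
      ≡⟨ cong (1ℚ * 0ℚ +_) (sym (Σ≤-distrib-+ n _ _)) ⟩
    1ℚ * 0ℚ + Σ≤ n (λ k → binom a (suc k) * H (suc k) + binom a k * H (suc k))
      ≡⟨ cong (1ℚ * 0ℚ +_) (Σ≤-cong′ n pascal) ⟩
    1ℚ * 0ℚ + Σ≤ n (λ k → binom (a + 1ℚ) (suc k) * H (suc k))
      ≡⟨ sym (Σ≤-suc n _) ⟩
    powS f (a + 1ℚ) (suc n) ∎
    where
    H : ℕ → ℚ
    H k = (h ^S k) (suc n)
    A = Σ≤ n (λ k → binom a (suc k) * H (suc k))
    B = Σ≤ n (λ k → binom a k * H (suc k))
    f≈1+h : f ≈ oneS ⊕ h
    f≈1+h zero    = add-back (f 0)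
      where
      add-back : ∀ x → x ≡ 1ℚ + (x - 1ℚ)
      add-back = solve-∀ ℚ-ring
    f≈1+h (suc n) = sym (+-identityˡ (f (suc n)))
    regroup : ∀ A B c → (1ℚ * 0ℚ + A) + (B + c * 0ℚ) ≡ 1ℚ * 0ℚ + (A + B)
    regroup = solve-∀ ℚ-ring
    pascal : ∀ k → binom a (suc k) * H (suc k) + binom a k * H (suc k)
                 ≡ binom (a + 1ℚ) (suc k) * H (suc k)
    pascal k = trans (sym (*-distribʳ-+ (H (suc k)) (binom a (suc k)) (binom a k)))
                     (cong (_* H (suc k)) (sym (binom-pascal a k)))

  powS-zero : powS f 0ℚ ≈ oneS
  powS-zero n = trans (Σ≤-head n _ (λ i → trans (cong (_* (h ^S suc i) n) (binom-zero-suc i))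
                                                (*-zeroˡ ((h ^S suc i) n))))
                      (*-identityˡ (oneS n))

  powS-ℕ : ∀ m → powS f (ℕ→ℚ m) ≈ f ^S m
  powS-ℕ zero        = powS-zero
  powS-ℕ (suc m) n = begin
    powS f (ℕ→ℚ (suc m)) n   ≡⟨ cong (λ z → powS f z n) (trans (ℕ→ℚ-suc m) (+-comm 1ℚ (ℕ→ℚ m))) ⟩
    powS f (ℕ→ℚ m + 1ℚ) n    ≡⟨ sym (powS-+1 (ℕ→ℚ m) n) ⟩
    (f ⊗ powS f (ℕ→ℚ m)) n   ≡⟨ ⊗-cong (≈-refl {f}) (powS-ℕ m) n ⟩
    (f ⊗ (f ^S m)) n         ≡⟨ ⊗-comm f (f ^S m) n ⟩
    (f ^S suc m) n           ∎

  powS-neg-suc : ∀ m → f ⊗ powS f (- ℕ→ℚ (suc m)) ≈ powS f (- ℕ→ℚ m)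
  powS-neg-suc m = ≈-trans (powS-+1 (- ℕ→ℚ (suc m))) (λ n → cong (λ z → powS f z n) exponent)
    where
    exponent : - ℕ→ℚ (suc m) + 1ℚ ≡ - ℕ→ℚ m
    exponent = trans (cong (λ z → - z + 1ℚ) (ℕ→ℚ-suc m)) (cancel (ℕ→ℚ m))
      where
      cancel : ∀ x → - (1ℚ + x) + 1ℚ ≡ - x
      cancel = solve-∀ ℚ-ring

  powS-neg-⊗-^S : ∀ m → powS f (- ℕ→ℚ m) ⊗ (f ^S m) ≈ oneS
  powS-neg-⊗-^S zero    = ≈-trans (⊗-identityʳ (powS f 0ℚ)) powS-zero
  powS-neg-⊗-^S (suc m) =
    powS f (- ℕ→ℚ (suc m)) ⊗ ((f ^S m) ⊗ f)   ≈⟨ rotate (powS f (- ℕ→ℚ (suc m))) (f ^S m) f ⟩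
    (f ⊗ powS f (- ℕ→ℚ (suc m))) ⊗ (f ^S m)   ≈⟨ ⊗-cong (powS-neg-suc m) (≈-refl {f ^S m}) ⟩
    powS f (- ℕ→ℚ m) ⊗ (f ^S m)               ≈⟨ powS-neg-⊗-^S m ⟩
    oneS                                      ∎ₛ
    where
    open SeriesSolver
    rotate : ∀ a b c → a ⊗ (b ⊗ c) ≈ (c ⊗ a) ⊗ b
    rotate = solve 3 (λ a b c → a :* (b :* c) := (c :* a) :* b) ≈-refl

onePlusT≈1+X : onePlusT ≈ constS 1ℚ ⊕ X
onePlusT≈1+X zero          = refl
onePlusT≈1+X (suc zero)    = refl
onePlusT≈1+X (suc (suc n)) = refl

onePlusT-⊗-suc : ∀ f n → (onePlusT ⊗ f) (suc n) ≡ f (suc n) + f n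
onePlusT-⊗-suc f n = begin
  (onePlusT ⊗ f) (suc n)                           ≡⟨ ⊗-cong onePlusT≈1+X (≈-refl {f}) (suc n) ⟩
  ((constS 1ℚ ⊕ X) ⊗ f) (suc n)                    ≡⟨ ⊗-distribʳ f (constS 1ℚ) X (suc n) ⟩
  (constS 1ℚ ⊗ f) (suc n) + (X ⊗ f) (suc n)        ≡⟨ cong₂ _+_ one-⊗ (X-⊗-suc f n) ⟩
  f (suc n) + f n                                  ∎
  where
  one-⊗ : (constS 1ℚ ⊗ f) (suc n) ≡ f (suc n)
  one-⊗ = trans (⊗-cong (≈-sym oneS≈constS1) (≈-refl {f}) (suc n)) (⊗-identityˡ f (suc n))

θ-onePlusT : θ onePlusT ≈ X
θ-onePlusT zero          = refl
θ-onePlusT (suc zero)    = refl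
θ-onePlusT (suc (suc n)) = *-zeroʳ (ℕ→ℚ (suc (suc n)))

θ-log1p/t : onePlusT ⊗ θ log1p/t ≈ constS 1ℚ ⊕ negS (onePlusT ⊗ log1p/t)
θ-log1p/t zero    = refl
θ-log1p/t (suc k) = begin
  (onePlusT ⊗ θ log1p/t) (suc k)
    ≡⟨ onePlusT-⊗-suc (θ log1p/t) k ⟩
  ℕ→ℚ (suc k) * (- σ * b) + κ * (σ * a)
    ≡⟨ cong (λ z → z * (- σ * b) + κ * (σ * a)) (ℕ→ℚ-suc k) ⟩
  (1ℚ + κ) * (- σ * b) + κ * (σ * a)
    ≡⟨ rearrange κ σ a b ⟩
  (0ℚ + - (- σ * b + σ * a)) + σ * ((1ℚ + κ) * a - (1ℚ + (1ℚ + κ)) * b)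
    ≡⟨ cong (λ z → (0ℚ + - (- σ * b + σ * a)) + σ * z) telescope ⟩
  (0ℚ + - (- σ * b + σ * a)) + σ * 0ℚ
    ≡⟨ trans (cong ((0ℚ + - (- σ * b + σ * a)) +_) (*-zeroʳ σ)) (+-identityʳ _) ⟩
  0ℚ + - (- σ * b + σ * a)
    ≡⟨ cong (λ z → 0ℚ + - z) (sym (onePlusT-⊗-suc log1p/t k)) ⟩
  (constS 1ℚ ⊕ negS (onePlusT ⊗ log1p/t)) (suc k) ∎
  where
  κ = ℕ→ℚ k
  σ = sgn k
  a = recipℕ (suc k)
  b = recipℕ (suc (suc k))
  rearrange : ∀ κ σ a b → (1ℚ + κ) * (- σ * b) + κ * (σ * a)
              ≡ (0ℚ + - (- σ * b + σ * a)) + σ * ((1ℚ + κ) * a - (1ℚ + (1ℚ + κ)) * b)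
  rearrange = solve-∀ ℚ-ring
  telescope : (1ℚ + κ) * a - (1ℚ + (1ℚ + κ)) * b ≡ 0ℚ
  telescope = trans (cong₂ (λ u v → u * a - v * b) (sym (ℕ→ℚ-suc k))
                           (trans (cong (1ℚ +_) (sym (ℕ→ℚ-suc k))) (sym (ℕ→ℚ-suc (suc k)))))
                    (trans (cong₂ _-_ (recipℕ-inverseʳ k) (recipℕ-inverseʳ (suc k))) (+-inverseʳ 1ℚ))

θ-expm1/t : θ expm1/t ≈ (constS 1ℚ ⊕ (X ⊗ expm1/t)) ⊕ negS expm1/t
θ-expm1/t zero    = refl
θ-expm1/t (suc k) = begin
  ℕ→ℚ (suc k) * (I * b)
    ≡⟨ rearrange (ℕ→ℚ (suc k)) I b ⟩
  ((0ℚ + I) + - (I * b)) + I * ((1ℚ + ℕ→ℚ (suc k)) * b - 1ℚ)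
    ≡⟨ cong (λ z → ((0ℚ + I) + - (I * b)) + I * (z * b - 1ℚ)) (sym (ℕ→ℚ-suc (suc k))) ⟩
  ((0ℚ + I) + - (I * b)) + I * (ℕ→ℚ (suc (suc k)) * b - 1ℚ)
    ≡⟨ cong (λ z → ((0ℚ + I) + - (I * b)) + I * (z - 1ℚ)) (recipℕ-inverseʳ (suc k)) ⟩
  ((0ℚ + I) + - (I * b)) + I * (1ℚ - 1ℚ)
    ≡⟨ cong (λ z → ((0ℚ + I) + - (I * b)) + I * z) (+-inverseʳ 1ℚ) ⟩
  ((0ℚ + I) + - (I * b)) + I * 0ℚ
    ≡⟨ trans (cong (((0ℚ + I) + - (I * b)) +_) (*-zeroʳ I)) (+-identityʳ _) ⟩
  (0ℚ + I) + - (I * b)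
    ≡⟨ cong (λ z → (0ℚ + z) + - (I * b)) (sym (X-⊗-suc expm1/t k)) ⟩
  ((constS 1ℚ ⊕ (X ⊗ expm1/t)) ⊕ negS expm1/t) (suc k) ∎
  where
  I = invFact (suc k)
  b = recipℕ (suc (suc k))
  rearrange : ∀ κ I b → κ * (I * b) ≡ ((0ℚ + I) + - (I * b)) + I * ((1ℚ + κ) * b - 1ℚ)
  rearrange = solve-∀ ℚ-ring

θ-expS : ∀ s → θ (expS s) ≈ constS s ⊗ (X ⊗ expS s)
θ-expS s zero    = trans (*-zeroˡ (expS s 0))
                         (sym (trans (constS-⊗ s (X ⊗ expS s) 0)
                                     (trans (cong (s *_) (X-⊗-zero (expS s))) (*-zeroʳ s))))
θ-expS s (suc k) = begin
  ℕ→ℚ (suc k) * ((s ^Q k * s) * (invFact k * recipℕ (suc k)))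
    ≡⟨ rearrange (ℕ→ℚ (suc k)) (s ^Q k) s (invFact k) (recipℕ (suc k)) ⟩
  s * expS s k * (ℕ→ℚ (suc k) * recipℕ (suc k))
    ≡⟨ cong (s * expS s k *_) (recipℕ-inverseʳ k) ⟩
  s * expS s k * 1ℚ
    ≡⟨ *-identityʳ _ ⟩
  s * expS s k
    ≡⟨ sym (constS-⊗-X-⊗ s (expS s) k) ⟩
  (constS s ⊗ (X ⊗ expS s)) (suc k) ∎
  where
  rearrange : ∀ κ p s i r → κ * ((p * s) * (i * r)) ≡ s * (p * i) * (κ * r)
  rearrange = solve-∀ ℚ-ring

1^Q≡1 : ∀ m → 1ℚ ^Q m ≡ 1ℚ
1^Q≡1 zero    = refl
1^Q≡1 (suc m) = cong (_* 1ℚ) (1^Q≡1 m)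

expm1≈X⊗expm1/t : expm1 ≈ X ⊗ expm1/t
expm1≈X⊗expm1/t zero    = refl
expm1≈X⊗expm1/t (suc k) =
  trans (trans (cong (_* invFact (suc k)) (1^Q≡1 (suc k))) (*-identityˡ _))
        (sym (X-⊗-suc expm1/t k))

-- The exponential side: ((e^t − 1)/t)^m e^(st) and r-Stirling numbers

expSide : ℕ → ℕ → Series
expSide s m = (expm1/t ^S m) ⊗ expS (ℕ→ℚ s)

expSide-zero-recurrence : ∀ s n → ℕ→ℚ (suc n) * expSide s 0 (suc n) ≡ ℕ→ℚ s * expSide s 0 n
expSide-zero-recurrence s n = begin
  θ (expSide s 0) (suc n)                   ≡⟨ θ-cong (⊗-identityˡ e) (suc n) ⟩
  θ e (suc n)                               ≡⟨ θ-expS (ℕ→ℚ s) (suc n) ⟩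
  (constS (ℕ→ℚ s) ⊗ (X ⊗ e)) (suc n)        ≡⟨ constS-⊗-X-⊗ (ℕ→ℚ s) e n ⟩
  ℕ→ℚ s * e n                               ≡⟨ cong (ℕ→ℚ s *_) (sym (⊗-identityˡ e n)) ⟩
  ℕ→ℚ s * expSide s 0 n                     ∎
  where
  e = expS (ℕ→ℚ s)

θ-expSide : ∀ s m → let c = constS (ℕ→ℚ (suc m)) in θ (expSide s (suc m)) ≈
  (((c ⊗ expSide s m) ⊕ (c ⊗ (X ⊗ expSide s (suc m)))) ⊕ negS (c ⊗ expSide s (suc m)))
    ⊕ (constS (ℕ→ℚ s) ⊗ (X ⊗ expSide s (suc m)))
θ-expSide s m =
  θ ((E ^S suc m) ⊗ e)
    ≈⟨ θ-⊗ (E ^S suc m) e ⟩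
  (θ (E ^S suc m) ⊗ e) ⊕ ((E ^S suc m) ⊗ θ e)
    ≈⟨ ⊕-cong (⊗-cong θ-E^S (≈-refl {e})) (⊗-cong (≈-refl {E ^S suc m}) (θ-expS (ℕ→ℚ s))) ⟩
  ((c ⊗ ((E ^S m) ⊗ ((constS 1ℚ ⊕ (X ⊗ E)) ⊕ negS E))) ⊗ e)
    ⊕ (((E ^S m) ⊗ E) ⊗ (constS (ℕ→ℚ s) ⊗ (X ⊗ e)))
    ≈⟨ expand c (constS (ℕ→ℚ s)) (E ^S m) E e X ⟩
  _ ∎ₛ
  where
  open SeriesSolver
  E = expm1/t
  e = expS (ℕ→ℚ s)
  c = constS (ℕ→ℚ (suc m))
  θ-E^S : θ (E ^S suc m) ≈ c ⊗ ((E ^S m) ⊗ ((constS 1ℚ ⊕ (X ⊗ E)) ⊕ negS E))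
  θ-E^S = ≈-trans (θ-^S E m) (⊗-cong (≈-refl {c}) (⊗-cong (≈-refl {E ^S m}) θ-expm1/t))
  expand : ∀ c cs Em E e X →
    ((c ⊗ (Em ⊗ ((constS 1ℚ ⊕ (X ⊗ E)) ⊕ negS E))) ⊗ e) ⊕ ((Em ⊗ E) ⊗ (cs ⊗ (X ⊗ e)))
    ≈ (((c ⊗ (Em ⊗ e)) ⊕ (c ⊗ (X ⊗ ((Em ⊗ E) ⊗ e)))) ⊕ negS (c ⊗ ((Em ⊗ E) ⊗ e)))
        ⊕ (cs ⊗ (X ⊗ ((Em ⊗ E) ⊗ e)))
  expand = solve 6 (λ c cs Em E e X →
    ((c :* (Em :* ((con 1ℚ :+ (X :* E)) :- E))) :* e) :+ ((Em :* E) :* (cs :* (X :* e)))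
    := (((c :* (Em :* e)) :+ (c :* (X :* ((Em :* E) :* e)))) :- (c :* ((Em :* E) :* e)))
         :+ (cs :* (X :* ((Em :* E) :* e)))) ≈-refl

expSide-recurrence : ∀ s m n →
  ℕ→ℚ (suc n +ℕ suc m) * expSide s (suc m) (suc n)
    ≡ ℕ→ℚ (suc m) * expSide s m (suc n) + ℕ→ℚ (suc m +ℕ s) * expSide s (suc m) n
expSide-recurrence s m n = begin
  ℕ→ℚ (suc n +ℕ suc m) * Q₁ (suc n)
    ≡⟨ cong (_* Q₁ (suc n)) (ℕ→ℚ-+ (suc n) (suc m)) ⟩
  (ν + μ) * Q₁ (suc n)
    ≡⟨ *-distribʳ-+ (Q₁ (suc n)) ν μ ⟩
  θ Q₁ (suc n) + μ * Q₁ (suc n)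
    ≡⟨ cong (_+ μ * Q₁ (suc n)) θ-Q₁ ⟩
  ((μ * Q₀ (suc n) + μ * Q₁ n) + - (μ * Q₁ (suc n)) + σ * Q₁ n) + μ * Q₁ (suc n)
    ≡⟨ collect μ σ (Q₀ (suc n)) (Q₁ n) (Q₁ (suc n)) ⟩
  μ * Q₀ (suc n) + (μ + σ) * Q₁ n
    ≡⟨ cong (λ z → μ * Q₀ (suc n) + z * Q₁ n) (sym (ℕ→ℚ-+ (suc m) s)) ⟩
  ℕ→ℚ (suc m) * expSide s m (suc n) + ℕ→ℚ (suc m +ℕ s) * expSide s (suc m) n ∎
  where
  Q₀ = expSide s m
  Q₁ = expSide s (suc m)
  ν = ℕ→ℚ (suc n)
  μ = ℕ→ℚ (suc m)
  σ = ℕ→ℚ s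
  θ-Q₁ : θ Q₁ (suc n) ≡ ((μ * Q₀ (suc n) + μ * Q₁ n) + - (μ * Q₁ (suc n)) + σ * Q₁ n)
  θ-Q₁ = trans (θ-expSide s m (suc n))
    (cong₂ _+_ (cong₂ _+_ (cong₂ _+_ (constS-⊗ μ Q₀ (suc n)) (constS-⊗-X-⊗ μ Q₁ n))
                          (cong -_ (constS-⊗ μ Q₁ (suc n))))
               (constS-⊗-X-⊗ σ Q₁ n))
  collect : ∀ μ σ a b c → ((μ * a + μ * b) + - (μ * c) + σ * b) + μ * c ≡ μ * a + (μ + σ) * b
  collect = solve-∀ ℚ-ring

C*!*!≡! : ∀ n k → k ≤ n → (n C k) *ℕ (k ! *ℕ (n ∸ k) !) ≡ n !
C*!*!≡! n k k≤n = trans (cong (_*ℕ (k ! *ℕ (n ∸ k) !)) (nCk≡n!/k![n-k]! k≤n))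
                        (m/n*n≡m {{ℕP._!*_!≢0 k (n ∸ k)}} (k![n∸k]!∣n! k≤n))

C≡suc : ∀ n k → k ≤ n → Σ ℕ λ c → n C k ≡ suc c
C≡suc n k k≤n with n C k | C*!*!≡! n k k≤n
... | zero  | e = ⊥-elim (ℕ.≢-nonZero⁻¹ (n !) {{ℕP._!≢0 n}} (sym e))
... | suc c | e = c , refl

rStirling≡expSide : ∀ s n m →
  rStirling s (n +ℕ m) m ≡ ℕ→ℚ ((n +ℕ m) !) * (invFact m * expSide s m n)
rStirling≡expSide s n m = cong (λ z → ℕ→ℚ ((n +ℕ m) !) * (invFact m * z)) (begin
  ((expm1 ^S m) ⊗ e) (n +ℕ m)
    ≡⟨ ⊗-cong (≈-trans (^S-cong m expm1≈X⊗expm1/t) (^S-distrib-⊗ m X expm1/t)) (≈-refl {e}) (n +ℕ m) ⟩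
  (((X ^S m) ⊗ (expm1/t ^S m)) ⊗ e) (n +ℕ m)
    ≡⟨ ⊗-assoc (X ^S m) (expm1/t ^S m) e (n +ℕ m) ⟩
  ((X ^S m) ⊗ expSide s m) (n +ℕ m)
    ≡⟨ X^S-⊗-shift m (expSide s m) n ⟩
  expSide s m n ∎)
  where
  e = expS (ℕ→ℚ s)

n!*expSide≡rStirling/C : ∀ s n m →
  ℕ→ℚ (n !) * expSide s m n ≡ rStirling s (n +ℕ m) m * recipℕ ((n +ℕ m) C n)
n!*expSide≡rStirling/C s n m with C≡suc (n +ℕ m) n (ℕP.m≤m+n n m) | C*!*!≡! (n +ℕ m) n (ℕP.m≤m+n n m)
... | c , C≡1+c | C*!*! = sym (begin
  rStirling s (n +ℕ m) m * recipℕ ((n +ℕ m) C n)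
    ≡⟨ cong₂ (λ u v → u * recipℕ v) (rStirling≡expSide s n m) C≡1+c ⟩
  ℕ→ℚ ((n +ℕ m) !) * (invFact m * Q) * recipℕ (suc c)
    ≡⟨ cong (λ z → ℕ→ℚ z * (invFact m * Q) * recipℕ (suc c)) (sym (1+c*!*!≡! )) ⟩
  ℕ→ℚ (suc c *ℕ (n ! *ℕ m !)) * (invFact m * Q) * recipℕ (suc c)
    ≡⟨ cong (λ z → z * (invFact m * Q) * recipℕ (suc c))
            (trans (ℕ→ℚ-* (suc c) (n ! *ℕ m !)) (cong (ℕ→ℚ (suc c) *_) (ℕ→ℚ-* (n !) (m !)))) ⟩
  ℕ→ℚ (suc c) * (ℕ→ℚ (n !) * ℕ→ℚ (m !)) * (invFact m * Q) * recipℕ (suc c)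
    ≡⟨ regroup (ℕ→ℚ (suc c)) (ℕ→ℚ (n !)) (ℕ→ℚ (m !)) (invFact m) Q (recipℕ (suc c)) ⟩
  (ℕ→ℚ (suc c) * recipℕ (suc c)) * (invFact m * ℕ→ℚ (m !)) * (ℕ→ℚ (n !) * Q)
    ≡⟨ cong₂ (λ u v → u * v * (ℕ→ℚ (n !) * Q)) (recipℕ-inverseʳ c) (invFact-*-! m) ⟩
  1ℚ * 1ℚ * (ℕ→ℚ (n !) * Q)
    ≡⟨ trans (cong (_* (ℕ→ℚ (n !) * Q)) (*-identityˡ 1ℚ)) (*-identityˡ _) ⟩
  ℕ→ℚ (n !) * Q ∎)
  where
  Q = expSide s m n
  1+c*!*!≡! : suc c *ℕ (n ! *ℕ m !) ≡ (n +ℕ m) !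
  1+c*!*!≡! = trans (cong₂ (λ u v → u *ℕ (n ! *ℕ v !)) (sym C≡1+c) (sym (ℕP.m+n∸m≡n n m))) C*!*!
  regroup : ∀ c a b i q r → c * (a * b) * (i * q) * r ≡ (c * r) * (i * b) * (a * q)
  regroup = solve-∀ ℚ-ring

-- The logarithmic side: (t/ln(1 + t))^K (1 + t)^r

invLogPow : ℕ → Series
invLogPow K = powS log1p/t (- ℕ→ℚ K)

onePlusTPow : ℕ → Series
onePlusTPow r = powS onePlusT (ℕ→ℚ r)

logSide : ℕ → ℕ → Series
logSide r K = invLogPow K ⊗ onePlusTPow r

invLogPow-⊗-^S : ∀ K → invLogPow K ⊗ (log1p/t ^S K) ≈ oneS
invLogPow-⊗-^S = powS-neg-⊗-^S log1p/t refl

log1p/t-⊗-invLogPow : ∀ K → log1p/t ⊗ invLogPow (suc K) ≈ invLogPow K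
log1p/t-⊗-invLogPow = powS-neg-suc log1p/t refl

log1p/t-⊗-cancel : ∀ {A B} → log1p/t ⊗ A ≈ log1p/t ⊗ B → A ≈ B
log1p/t-⊗-cancel {A} {B} LA≈LB =
  A                                      ≈⟨ ≈-sym (unit A) ⟩
  (invLogPow 1 ⊗ (oneS ⊗ log1p/t)) ⊗ A   ≈⟨ reassoc (invLogPow 1) oneS log1p/t A ⟩
  (invLogPow 1 ⊗ oneS) ⊗ (log1p/t ⊗ A)   ≈⟨ ⊗-cong (≈-refl {invLogPow 1 ⊗ oneS}) LA≈LB ⟩
  (invLogPow 1 ⊗ oneS) ⊗ (log1p/t ⊗ B)   ≈⟨ ≈-sym (reassoc (invLogPow 1) oneS log1p/t B) ⟩
  (invLogPow 1 ⊗ (oneS ⊗ log1p/t)) ⊗ B   ≈⟨ unit B ⟩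
  B                                      ∎ₛ
  where
  open SeriesSolver
  unit : ∀ C → (invLogPow 1 ⊗ (oneS ⊗ log1p/t)) ⊗ C ≈ C
  unit C = ≈-trans (⊗-cong (invLogPow-⊗-^S 1) (≈-refl {C})) (⊗-identityˡ C)
  reassoc : ∀ w u l a → (w ⊗ (u ⊗ l)) ⊗ a ≈ (w ⊗ u) ⊗ (l ⊗ a)
  reassoc = solve 4 (λ w u l a → (w :* (u :* l)) :* a := (w :* u) :* (l :* a)) ≈-refl

-- Apply θ to invLogPow (K + 1) ⊗ log1p/t ^S (K + 1) ≈ oneS.
log1p/t-⊗-θ-invLogPow : ∀ K → log1p/t ⊗ θ (invLogPow (suc K))
                              ≈ negS (constS (ℕ→ℚ (suc K)) ⊗ (θ log1p/t ⊗ invLogPow (suc K)))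
log1p/t-⊗-θ-invLogPow K =
  L ⊗ θW
    ≈⟨ ≈-sym (≈-trans (⊗-cong (≈-refl {L ⊗ θW}) (invLogPow-⊗-^S (suc K))) (⊗-identityʳ (L ⊗ θW))) ⟩
  (L ⊗ θW) ⊗ (W ⊗ Lᴷ)
    ≈⟨ expand L θW W Lᴷ (θ Lᴷ) ⟩
  ((W ⊗ L) ⊗ ((θW ⊗ Lᴷ) ⊕ (W ⊗ θ Lᴷ))) ⊕ negS ((W ⊗ W) ⊗ (L ⊗ θ Lᴷ))
    ≈⟨ ⊕-cong (⊗-cong (≈-refl {W ⊗ L}) θ[W⊗Lᴷ]≈0)
              (negS-cong (⊗-cong (≈-refl {W ⊗ W}) (⊗-cong (≈-refl {L}) (θ-^S L K)))) ⟩
  ((W ⊗ L) ⊗ constS 0ℚ) ⊕ negS ((W ⊗ W) ⊗ (L ⊗ (c ⊗ ((L ^S K) ⊗ θ L))))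
    ≈⟨ contract W L c (θ L) (L ^S K) ⟩
  negS ((c ⊗ (θ L ⊗ W)) ⊗ (W ⊗ Lᴷ))
    ≈⟨ negS-cong (≈-trans (⊗-cong (≈-refl {c ⊗ (θ L ⊗ W)}) (invLogPow-⊗-^S (suc K)))
                          (⊗-identityʳ (c ⊗ (θ L ⊗ W)))) ⟩
  negS (c ⊗ (θ L ⊗ W)) ∎ₛ
  where
  open SeriesSolver
  L  = log1p/t
  W  = invLogPow (suc K)
  θW = θ W
  Lᴷ = L ^S suc K
  c  = constS (ℕ→ℚ (suc K))
  θ[W⊗Lᴷ]≈0 : (θW ⊗ Lᴷ) ⊕ (W ⊗ θ Lᴷ) ≈ constS 0ℚ
  θ[W⊗Lᴷ]≈0 = ≈-trans (≈-sym (θ-⊗ W Lᴷ)) (≈-trans (θ-cong (invLogPow-⊗-^S (suc K))) θ-oneS)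
  expand : ∀ L θW W Lᴷ θLᴷ → (L ⊗ θW) ⊗ (W ⊗ Lᴷ)
           ≈ ((W ⊗ L) ⊗ ((θW ⊗ Lᴷ) ⊕ (W ⊗ θLᴷ))) ⊕ negS ((W ⊗ W) ⊗ (L ⊗ θLᴷ))
  expand = solve 5 (λ L θW W Lᴷ θLᴷ → (L :* θW) :* (W :* Lᴷ)
    := ((W :* L) :* ((θW :* Lᴷ) :+ (W :* θLᴷ))) :- ((W :* W) :* (L :* θLᴷ))) ≈-refl
  contract : ∀ W L c θL Lᴷ′ → ((W ⊗ L) ⊗ constS 0ℚ) ⊕ negS ((W ⊗ W) ⊗ (L ⊗ (c ⊗ (Lᴷ′ ⊗ θL))))
             ≈ negS ((c ⊗ (θL ⊗ W)) ⊗ (W ⊗ (Lᴷ′ ⊗ L)))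
  contract = solve 5 (λ W L c θL Lᴷ′ → ((W :* L) :* con 0ℚ) :- ((W :* W) :* (L :* (c :* (Lᴷ′ :* θL))))
    := :- ((c :* (θL :* W)) :* (W :* (Lᴷ′ :* L)))) ≈-refl

θ-onePlusTPow : ∀ r → onePlusT ⊗ θ (onePlusTPow r) ≈ constS (ℕ→ℚ r) ⊗ (X ⊗ onePlusTPow r)
θ-onePlusTPow zero =
  onePlusT ⊗ θ (onePlusTPow 0)
    ≈⟨ ⊗-cong (≈-refl {onePlusT}) (≈-trans (θ-cong (powS-zero onePlusT refl)) θ-oneS) ⟩
  onePlusT ⊗ constS 0ℚ
    ≈⟨ annihilate onePlusT (X ⊗ onePlusTPow 0) ⟩
  constS 0ℚ ⊗ (X ⊗ onePlusTPow 0) ∎ₛ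
  where
  open SeriesSolver
  annihilate : ∀ o Y → o ⊗ constS 0ℚ ≈ constS 0ℚ ⊗ Y
  annihilate = solve 2 (λ o Y → o :* con 0ℚ := con 0ℚ :* Y) ≈-refl
θ-onePlusTPow (suc r) =
  onePlusT ⊗ θ (onePlusTPow (suc r))
    ≈⟨ ⊗-cong (≈-refl {onePlusT}) θ-power ⟩
  onePlusT ⊗ (c ⊗ ((onePlusT ^S r) ⊗ X))
    ≈⟨ reorder onePlusT c (onePlusT ^S r) X ⟩
  c ⊗ (X ⊗ (onePlusT ^S suc r))
    ≈⟨ ⊗-cong (≈-refl {c}) (⊗-cong (≈-refl {X}) (≈-sym (powS-ℕ onePlusT refl (suc r)))) ⟩
  c ⊗ (X ⊗ onePlusTPow (suc r)) ∎ₛ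
  where
  open SeriesSolver
  c = constS (ℕ→ℚ (suc r))
  θ-power : θ (onePlusTPow (suc r)) ≈ c ⊗ ((onePlusT ^S r) ⊗ X)
  θ-power = ≈-trans (θ-cong (powS-ℕ onePlusT refl (suc r)))
            (≈-trans (θ-^S onePlusT r) (⊗-cong (≈-refl {c}) (⊗-cong (≈-refl {onePlusT ^S r}) θ-onePlusT)))
  reorder : ∀ o c p X → o ⊗ (c ⊗ (p ⊗ X)) ≈ c ⊗ (X ⊗ (p ⊗ o))
  reorder = solve 4 (λ o c p X → o :* (c :* (p :* X)) := c :* (X :* (p :* o))) ≈-refl

module _ (r K : ℕ) where

  private
    L W P G c cr o : Series
    L  = log1p/t
    W  = invLogPow (suc K)
    P  = onePlusTPow r
    G  = logSide r (suc K)
    c  = constS (ℕ→ℚ (suc K))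
    cr = constS (ℕ→ℚ r)
    o  = onePlusT

  log1p/t-⊗-onePlusT-⊗-θ-logSide : L ⊗ (o ⊗ θ G) ≈ (cr ⊗ (X ⊗ (L ⊗ G))) ⊕ negS ((c ⊗ G) ⊗ (o ⊗ θ L))
  log1p/t-⊗-onePlusT-⊗-θ-logSide =
    L ⊗ (o ⊗ θ G)
      ≈⟨ ⊗-cong (≈-refl {L}) (⊗-cong (≈-refl {o}) (θ-⊗ W P)) ⟩
    L ⊗ (o ⊗ ((θ W ⊗ P) ⊕ (W ⊗ θ P)))
      ≈⟨ distribute L o W P (θ W) (θ P) ⟩
    ((o ⊗ P) ⊗ (L ⊗ θ W)) ⊕ ((L ⊗ W) ⊗ (o ⊗ θ P))
      ≈⟨ ⊕-cong (⊗-cong (≈-refl {o ⊗ P}) (log1p/t-⊗-θ-invLogPow K))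
                (⊗-cong (≈-refl {L ⊗ W}) (θ-onePlusTPow r)) ⟩
    ((o ⊗ P) ⊗ negS (c ⊗ (θ L ⊗ W))) ⊕ ((L ⊗ W) ⊗ (cr ⊗ (X ⊗ P)))
      ≈⟨ regroup L o W P c cr X (θ L) ⟩
    (cr ⊗ (X ⊗ (L ⊗ G))) ⊕ negS ((c ⊗ G) ⊗ (o ⊗ θ L)) ∎ₛ
    where
    open SeriesSolver
    distribute : ∀ L o W P θW θP → L ⊗ (o ⊗ ((θW ⊗ P) ⊕ (W ⊗ θP)))
                 ≈ ((o ⊗ P) ⊗ (L ⊗ θW)) ⊕ ((L ⊗ W) ⊗ (o ⊗ θP))
    distribute = solve 6 (λ L o W P θW θP → L :* (o :* ((θW :* P) :+ (W :* θP)))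
      := ((o :* P) :* (L :* θW)) :+ ((L :* W) :* (o :* θP))) ≈-refl
    regroup : ∀ L o W P c cr X θL
              → ((o ⊗ P) ⊗ negS (c ⊗ (θL ⊗ W))) ⊕ ((L ⊗ W) ⊗ (cr ⊗ (X ⊗ P)))
              ≈ (cr ⊗ (X ⊗ (L ⊗ (W ⊗ P)))) ⊕ negS ((c ⊗ (W ⊗ P)) ⊗ (o ⊗ θL))
    regroup = solve 8 (λ L o W P c cr X θL
      → ((o :* P) :* (:- (c :* (θL :* W)))) :+ ((L :* W) :* (cr :* (X :* P)))
      := (cr :* (X :* (L :* (W :* P)))) :- ((c :* (W :* P)) :* (o :* θL))) ≈-refl

  -- After multiplication by log1p/t both sides become c ⊗ G.
  logSide-recurrenceₛ : c ⊗ logSide r (suc (suc K)) ≈ (c ⊗ G) ⊕ (((c ⊕ cr) ⊗ (X ⊗ G)) ⊕ negS (o ⊗ θ G))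
  logSide-recurrenceₛ = log1p/t-⊗-cancel (
    L ⊗ (c ⊗ logSide r (suc (suc K)))
      ≈⟨ pull L c (invLogPow (suc (suc K))) P ⟩
    c ⊗ ((L ⊗ invLogPow (suc (suc K))) ⊗ P)
      ≈⟨ ⊗-cong (≈-refl {c}) (⊗-cong (log1p/t-⊗-invLogPow (suc K)) (≈-refl {P})) ⟩
    c ⊗ G
      ≈⟨ ≈-sym L⊗rhs≈c⊗G ⟩
    L ⊗ ((c ⊗ G) ⊕ (((c ⊕ cr) ⊗ (X ⊗ G)) ⊕ negS (o ⊗ θ G))) ∎ₛ)
    where
    open SeriesSolver
    pull : ∀ L c W P → L ⊗ (c ⊗ (W ⊗ P)) ≈ c ⊗ ((L ⊗ W) ⊗ P)
    pull = solve 4 (λ L c W P → L :* (c :* (W :* P)) := c :* ((L :* W) :* P)) ≈-refl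
    o⊗θL : o ⊗ θ L ≈ constS 1ℚ ⊕ negS ((constS 1ℚ ⊕ X) ⊗ L)
    o⊗θL = ≈-trans θ-log1p/t (⊕-cong (≈-refl {constS 1ℚ}) (negS-cong (⊗-cong onePlusT≈1+X (≈-refl {L}))))
    L⊗o⊗θG : L ⊗ (o ⊗ θ G)
             ≈ (cr ⊗ (X ⊗ (L ⊗ G))) ⊕ negS ((c ⊗ G) ⊗ (constS 1ℚ ⊕ negS ((constS 1ℚ ⊕ X) ⊗ L)))
    L⊗o⊗θG = ≈-trans log1p/t-⊗-onePlusT-⊗-θ-logSide
      (⊕-cong (≈-refl {cr ⊗ (X ⊗ (L ⊗ G))}) (negS-cong (⊗-cong (≈-refl {c ⊗ G}) o⊗θL)))
    distribute : ∀ L c cr G X Z → L ⊗ ((c ⊗ G) ⊕ (((c ⊕ cr) ⊗ (X ⊗ G)) ⊕ negS Z))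
                 ≈ (c ⊗ (L ⊗ G)) ⊕ (((c ⊕ cr) ⊗ (X ⊗ (L ⊗ G))) ⊕ negS (L ⊗ Z))
    distribute = solve 6 (λ L c cr G X Z → L :* ((c :* G) :+ (((c :+ cr) :* (X :* G)) :- Z))
      := (c :* (L :* G)) :+ (((c :+ cr) :* (X :* (L :* G))) :- (L :* Z))) ≈-refl
    cancel : ∀ L c cr G X → (c ⊗ (L ⊗ G)) ⊕ (((c ⊕ cr) ⊗ (X ⊗ (L ⊗ G)))
               ⊕ negS ((cr ⊗ (X ⊗ (L ⊗ G))) ⊕ negS ((c ⊗ G) ⊗ (constS 1ℚ ⊕ negS ((constS 1ℚ ⊕ X) ⊗ L)))))
             ≈ c ⊗ G
    cancel = solve 5 (λ L c cr G X → (c :* (L :* G)) :+ (((c :+ cr) :* (X :* (L :* G)))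
               :- ((cr :* (X :* (L :* G))) :- ((c :* G) :* (con 1ℚ :- ((con 1ℚ :+ X) :* L)))))
      := c :* G) ≈-refl
    L⊗rhs≈c⊗G : L ⊗ ((c ⊗ G) ⊕ (((c ⊕ cr) ⊗ (X ⊗ G)) ⊕ negS (o ⊗ θ G))) ≈ c ⊗ G
    L⊗rhs≈c⊗G =
      L ⊗ ((c ⊗ G) ⊕ (((c ⊕ cr) ⊗ (X ⊗ G)) ⊕ negS (o ⊗ θ G)))
        ≈⟨ distribute L c cr G X (o ⊗ θ G) ⟩
      (c ⊗ (L ⊗ G)) ⊕ (((c ⊕ cr) ⊗ (X ⊗ (L ⊗ G))) ⊕ negS (L ⊗ (o ⊗ θ G)))
        ≈⟨ ⊕-cong (≈-refl {c ⊗ (L ⊗ G)}) (⊕-cong (≈-refl {(c ⊕ cr) ⊗ (X ⊗ (L ⊗ G))}) (negS-cong L⊗o⊗θG)) ⟩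
      _
        ≈⟨ cancel L c cr G X ⟩
      c ⊗ G ∎ₛ

logSide-recurrence : ∀ r K n → let G = logSide r (suc K) ; κ = ℕ→ℚ (suc K) in
  κ * logSide r (suc (suc K)) (suc n)
    ≡ κ * G (suc n) + ((κ + ℕ→ℚ r) * G n + - (ℕ→ℚ (suc n) * G (suc n) + ℕ→ℚ n * G n))
logSide-recurrence r K n = begin
  κ * logSide r (suc (suc K)) (suc n)
    ≡⟨ sym (constS-⊗ κ (logSide r (suc (suc K))) (suc n)) ⟩
  (constS κ ⊗ logSide r (suc (suc K))) (suc n)
    ≡⟨ logSide-recurrenceₛ r K (suc n) ⟩
  (constS κ ⊗ G) (suc n) + (((constS κ ⊕ constS ρ) ⊗ (X ⊗ G)) (suc n) + - (onePlusT ⊗ θ G) (suc n))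
    ≡⟨ cong₂ _+_ (constS-⊗ κ G (suc n)) (cong₂ _+_ shifted (cong -_ (onePlusT-⊗-suc (θ G) n))) ⟩
  κ * G (suc n) + ((κ + ρ) * G n + - (ℕ→ℚ (suc n) * G (suc n) + ℕ→ℚ n * G n)) ∎
  where
  G = logSide r (suc K)
  κ = ℕ→ℚ (suc K)
  ρ = ℕ→ℚ r
  shifted : ((constS κ ⊕ constS ρ) ⊗ (X ⊗ G)) (suc n) ≡ (κ + ρ) * G n
  shifted = trans (⊗-cong (≈-sym (constS-+ κ ρ)) (≈-refl {X ⊗ G}) (suc n)) (constS-⊗-X-⊗ (κ + ρ) G n)

-- Both sides obey the recurrences above (with K = n + m + 1) and agree at n = 0.
logSide≡expSide : ∀ r n m → logSide r (suc (n +ℕ m)) n ≡ expSide (suc r) m n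
logSide≡expSide r zero    m = sym (cong (_* expS (ℕ→ℚ (suc r)) 0) (trans (^S-zero expm1/t m) (1^Q≡1 m)))
logSide≡expSide r (suc n) zero = ℕ→ℚ-suc-*-cancelˡ (n +ℕ 0) _ _ (begin
  κ * logSide r (suc (suc n +ℕ 0)) (suc n)
    ≡⟨ logSide-recurrence r (n +ℕ 0) n ⟩
  κ * G (suc n) + ((κ + ρ) * G n + - (ℕ→ℚ (suc n) * G (suc n) + ν * G n))
    ≡⟨ cong (λ z → z * G (suc n) + ((z + ρ) * G n + - (ℕ→ℚ (suc n) * G (suc n) + ν * G n))) κ≡ ⟩
  ℕ→ℚ (suc n) * G (suc n) + ((ℕ→ℚ (suc n) + ρ) * G n + - (ℕ→ℚ (suc n) * G (suc n) + ν * G n))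
    ≡⟨ cong (λ z → z * G (suc n) + ((z + ρ) * G n + - (z * G (suc n) + ν * G n))) (ℕ→ℚ-suc n) ⟩
  (1ℚ + ν) * G (suc n) + (((1ℚ + ν) + ρ) * G n + - ((1ℚ + ν) * G (suc n) + ν * G n))
    ≡⟨ collect ν ρ (G (suc n)) (G n) ⟩
  (1ℚ + ρ) * G n
    ≡⟨ cong₂ _*_ (sym (ℕ→ℚ-suc r)) (logSide≡expSide r n 0) ⟩
  ℕ→ℚ (suc r) * expSide (suc r) 0 n
    ≡⟨ sym (expSide-zero-recurrence (suc r) n) ⟩
  ℕ→ℚ (suc n) * expSide (suc r) 0 (suc n)
    ≡⟨ cong (_* expSide (suc r) 0 (suc n)) (sym κ≡) ⟩
  κ * expSide (suc r) 0 (suc n) ∎)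
  where
  κ = ℕ→ℚ (suc (n +ℕ 0))
  ν = ℕ→ℚ n
  ρ = ℕ→ℚ r
  G = logSide r (suc (n +ℕ 0))
  κ≡ : κ ≡ ℕ→ℚ (suc n)
  κ≡ = cong (λ z → ℕ→ℚ (suc z)) (ℕP.+-identityʳ n)
  collect : ∀ ν ρ a b → (1ℚ + ν) * a + (((1ℚ + ν) + ρ) * b + - ((1ℚ + ν) * a + ν * b)) ≡ (1ℚ + ρ) * b
  collect = solve-∀ ℚ-ring
logSide≡expSide r (suc n) (suc m) = ℕ→ℚ-suc-*-cancelˡ (n +ℕ suc m) _ _ (begin
  κ * logSide r (suc (suc n +ℕ suc m)) (suc n)
    ≡⟨ logSide-recurrence r (n +ℕ suc m) n ⟩
  κ * G (suc n) + ((κ + ρ) * G n + - (ℕ→ℚ (suc n) * G (suc n) + ν * G n))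
    ≡⟨ cong₂ (λ u v → u * G (suc n) + ((u + ρ) * G n + - (v * G (suc n) + ν * G n))) κ≡ (ℕ→ℚ-suc n) ⟩
  ((1ℚ + ν) + μ) * G (suc n) + ((((1ℚ + ν) + μ) + ρ) * G n + - ((1ℚ + ν) * G (suc n) + ν * G n))
    ≡⟨ collect ν μ ρ (G (suc n)) (G n) ⟩
  μ * G (suc n) + (μ + (1ℚ + ρ)) * G n
    ≡⟨ cong₂ (λ u v → μ * u + v * G n) G-suc (sym μ+1+ρ≡) ⟩
  μ * expSide (suc r) m (suc n) + ℕ→ℚ (suc m +ℕ suc r) * G n
    ≡⟨ cong (λ z → μ * expSide (suc r) m (suc n) + ℕ→ℚ (suc m +ℕ suc r) * z)
            (logSide≡expSide r n (suc m)) ⟩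
  μ * expSide (suc r) m (suc n) + ℕ→ℚ (suc m +ℕ suc r) * expSide (suc r) (suc m) n
    ≡⟨ sym (expSide-recurrence (suc r) m n) ⟩
  κ * expSide (suc r) (suc m) (suc n) ∎)
  where
  κ = ℕ→ℚ (suc n +ℕ suc m)
  ν = ℕ→ℚ n
  μ = ℕ→ℚ (suc m)
  ρ = ℕ→ℚ r
  G = logSide r (suc (n +ℕ suc m))
  κ≡ : κ ≡ (1ℚ + ν) + μ
  κ≡ = trans (ℕ→ℚ-+ (suc n) (suc m)) (cong (_+ μ) (ℕ→ℚ-suc n))
  μ+1+ρ≡ : ℕ→ℚ (suc m +ℕ suc r) ≡ μ + (1ℚ + ρ)
  μ+1+ρ≡ = trans (ℕ→ℚ-+ (suc m) (suc r)) (cong (μ +_) (ℕ→ℚ-suc r))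
  G-suc : G (suc n) ≡ expSide (suc r) m (suc n)
  G-suc = trans (cong (λ z → logSide r (suc z) (suc n)) (ℕP.+-suc n m)) (logSide≡expSide r (suc n) m)
  collect : ∀ ν μ ρ a b → ((1ℚ + ν) + μ) * a + ((((1ℚ + ν) + μ) + ρ) * b + - ((1ℚ + ν) * a + ν * b))
                          ≡ μ * a + (μ + (1ℚ + ρ)) * b
  collect = solve-∀ ℚ-ring

-- Polynomial functions and Lagrange interpolation

evalPoly : List ℚ → ℚ → ℚ
evalPoly []       x = 0ℚ
evalPoly (c ∷ cs) x = c + x * evalPoly cs x

IsPoly : ℕ → (ℚ → ℚ) → Set
IsPoly d g = Σ (List ℚ) λ cs → (length cs ≤ suc d) × (∀ x → evalPoly cs x ≡ g x)

addPoly : List ℚ → List ℚ → List ℚ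
addPoly []      q       = q
addPoly (a ∷ p) []      = a ∷ p
addPoly (a ∷ p) (b ∷ q) = (a + b) ∷ addPoly p q

addPoly-length : ∀ k p q → length p ≤ k → length q ≤ k → length (addPoly p q) ≤ k
addPoly-length k       []      q       lp        lq        = lq
addPoly-length k       (a ∷ p) []      lp        lq        = lp
addPoly-length (suc k) (a ∷ p) (b ∷ q) (s≤s lp) (s≤s lq) = s≤s (addPoly-length k p q lp lq)

addPoly-eval : ∀ p q x → evalPoly (addPoly p q) x ≡ evalPoly p x + evalPoly q x
addPoly-eval []      q       x = sym (+-identityˡ (evalPoly q x))
addPoly-eval (a ∷ p) []      x = sym (+-identityʳ (a + x * evalPoly p x))
addPoly-eval (a ∷ p) (b ∷ q) x =
  trans (cong (λ z → (a + b) + x * z) (addPoly-eval p q x))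
        (interchange a b x (evalPoly p x) (evalPoly q x))
  where
  interchange : ∀ a b x u v → (a + b) + x * (u + v) ≡ (a + x * u) + (b + x * v)
  interchange = solve-∀ ℚ-ring

scalePoly-eval : ∀ c p x → evalPoly (map (c *_) p) x ≡ c * evalPoly p x
scalePoly-eval c []      x = sym (*-zeroʳ c)
scalePoly-eval c (a ∷ p) x =
  trans (cong (λ z → c * a + x * z) (scalePoly-eval c p x)) (factor c a x (evalPoly p x))
  where
  factor : ∀ c a x u → c * a + x * (c * u) ≡ c * (a + x * u)
  factor = solve-∀ ℚ-ring

poly-const : ∀ c → IsPoly 0 (λ _ → c)
poly-const c = c ∷ [] , s≤s z≤n , λ x → trans (cong (c +_) (*-zeroʳ x)) (+-identityʳ c)

poly-weaken : ∀ {d e g} → d ≤ e → IsPoly d g → IsPoly e g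
poly-weaken d≤e (cs , len , ev) = cs , ℕP.≤-trans len (s≤s d≤e) , ev

poly-cong : ∀ {d g g′} → (∀ x → g x ≡ g′ x) → IsPoly d g → IsPoly d g′
poly-cong g≗g′ (cs , len , ev) = cs , len , λ x → trans (ev x) (g≗g′ x)

poly-+ : ∀ {d g g′} → IsPoly d g → IsPoly d g′ → IsPoly d (λ x → g x + g′ x)
poly-+ (p , lp , ep) (q , lq , eq) =
  addPoly p q , addPoly-length _ p q lp lq , λ x → trans (addPoly-eval p q x) (cong₂ _+_ (ep x) (eq x))

poly-scale : ∀ {d g} c → IsPoly d g → IsPoly d (λ x → c * g x)
poly-scale c (p , lp , ep) =
  map (c *_) p , ℕP.≤-trans (ℕP.≤-reflexive (length-map (c *_) p)) lp ,
  λ x → trans (scalePoly-eval c p x) (cong (c *_) (ep x))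

poly-*-affine : ∀ {d g} u v → IsPoly d g → IsPoly (suc d) (λ x → g x * (u * x + v))
poly-*-affine {d} u v (p , lp , ep) =
  addPoly (map (v *_) p) (0ℚ ∷ map (u *_) p) ,
  addPoly-length (suc (suc d)) (map (v *_) p) (0ℚ ∷ map (u *_) p)
    (ℕP.≤-trans (ℕP.≤-reflexive (length-map (v *_) p)) (ℕP.m≤n⇒m≤1+n lp))
    (s≤s (ℕP.≤-trans (ℕP.≤-reflexive (length-map (u *_) p)) lp)) ,
  λ x → begin
    evalPoly (addPoly (map (v *_) p) (0ℚ ∷ map (u *_) p)) x
      ≡⟨ addPoly-eval (map (v *_) p) (0ℚ ∷ map (u *_) p) x ⟩
    evalPoly (map (v *_) p) x + (0ℚ + x * evalPoly (map (u *_) p) x)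
      ≡⟨ cong₂ (λ a b → a + (0ℚ + x * b)) (scalePoly-eval v p x) (scalePoly-eval u p x) ⟩
    v * evalPoly p x + (0ℚ + x * (u * evalPoly p x))
      ≡⟨ factor u v x (evalPoly p x) ⟩
    evalPoly p x * (u * x + v)
      ≡⟨ cong (_* (u * x + v)) (ep x) ⟩
    _ ∎
  where
  factor : ∀ u v x e → v * e + (0ℚ + x * (u * e)) ≡ e * (u * x + v)
  factor = solve-∀ ℚ-ring

poly-Σ≤ : ∀ {d} n (F : ℕ → ℚ → ℚ) → (∀ i → i ≤ n → IsPoly d (F i)) →
          IsPoly d (λ x → Σ≤ n (λ i → F i x))
poly-Σ≤ zero    F poly = poly 0 z≤n
poly-Σ≤ (suc n) F poly =
  poly-+ (poly-Σ≤ n F (λ i i≤n → poly i (ℕP.m≤n⇒m≤1+n i≤n))) (poly (suc n) ℕP.≤-refl)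

poly-neg : ∀ {d g} → IsPoly d g → IsPoly d (λ x → - g x)
poly-neg {d} {g} g-poly = poly-cong (λ x → sym (-‿≡-1* (g x))) (poly-scale (- 1ℚ) g-poly)
  where
  -‿≡-1* : ∀ y → - y ≡ - 1ℚ * y
  -‿≡-1* = solve-∀ ℚ-ring

syntheticDivision : List ℚ → ℚ → List ℚ
syntheticDivision []           c = []
syntheticDivision (a ∷ [])     c = []
syntheticDivision (a ∷ b ∷ bs) c = evalPoly (b ∷ bs) c ∷ syntheticDivision (b ∷ bs) c

syntheticDivision-length : ∀ p c → length (syntheticDivision p c) ≡ length p ∸ 1
syntheticDivision-length []           c = refl
syntheticDivision-length (a ∷ [])     c = refl
syntheticDivision-length (a ∷ b ∷ bs) c = cong suc (syntheticDivision-length (b ∷ bs) c)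

syntheticDivision-eval : ∀ p c x →
  evalPoly p x ≡ evalPoly p c + (x - c) * evalPoly (syntheticDivision p c) x
syntheticDivision-eval []           c x = sym (trans (cong (0ℚ +_) (*-zeroʳ (x - c))) (+-identityʳ 0ℚ))
syntheticDivision-eval (a ∷ [])     c x = constant a x c
  where
  constant : ∀ a x c → a + x * 0ℚ ≡ (a + c * 0ℚ) + (x - c) * 0ℚ
  constant = solve-∀ ℚ-ring
syntheticDivision-eval (a ∷ b ∷ bs) c x =
  trans (cong (λ z → a + x * z) (syntheticDivision-eval (b ∷ bs) c x))
        (horner a x c (evalPoly (b ∷ bs) c) (evalPoly (syntheticDivision (b ∷ bs) c) x))
  where
  horner : ∀ a x c E Q → a + x * (E + (x - c) * Q) ≡ (a + c * E) + (x - c) * (E + x * Q)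
  horner = solve-∀ ℚ-ring

evalPoly-roots : ∀ k p → length p ≤ k → (∀ j → j < k → evalPoly p (- ℕ→ℚ j) ≡ 0ℚ) →
                 ∀ x → evalPoly p x ≡ 0ℚ
evalPoly-roots zero    []  _   _     x = refl
evalPoly-roots (suc k) p   len roots x = begin
  evalPoly p x                               ≡⟨ syntheticDivision-eval p c x ⟩
  evalPoly p c + (x - c) * evalPoly q x      ≡⟨ cong₂ (λ u v → u + (x - c) * v) (roots k ℕP.≤-refl)
                                                      (evalPoly-roots k q len-q roots-q x) ⟩
  0ℚ + (x - c) * 0ℚ                          ≡⟨ trans (cong (0ℚ +_) (*-zeroʳ (x - c))) (+-identityʳ 0ℚ) ⟩
  0ℚ                                         ∎
  where
  c = - ℕ→ℚ k
  q = syntheticDivision p c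
  len-q : length q ≤ k
  len-q = ℕP.≤-trans (ℕP.≤-reflexive (syntheticDivision-length p c)) (ℕP.∸-monoˡ-≤ 1 len)
  quotient-root : ∀ j → j < k → (- ℕ→ℚ j - c) * evalPoly q (- ℕ→ℚ j) ≡ 0ℚ
  quotient-root j j<k = begin
    (y - c) * evalPoly q y                   ≡⟨ sym (+-identityˡ ((y - c) * evalPoly q y)) ⟩
    0ℚ + (y - c) * evalPoly q y              ≡⟨ cong (_+ (y - c) * evalPoly q y) (sym (roots k ℕP.≤-refl)) ⟩
    evalPoly p c + (y - c) * evalPoly q y    ≡⟨ sym (syntheticDivision-eval p c y) ⟩
    evalPoly p y                             ≡⟨ roots j (ℕP.m≤n⇒m≤1+n j<k) ⟩
    0ℚ                                       ∎
    where y = - ℕ→ℚ j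
  roots-q : ∀ j → j < k → evalPoly q (- ℕ→ℚ j) ≡ 0ℚ
  roots-q j j<k with zero-product (- ℕ→ℚ j - c) (evalPoly q (- ℕ→ℚ j)) (quotient-root j j<k)
  ... | inj₂ q≡0   = q≡0
  ... | inj₁ k-j≡0 = ⊥-elim (ℕ→ℚ-suc≢0 (k ∸ suc j) (begin
      ℕ→ℚ (suc (k ∸ suc j))    ≡⟨ cong ℕ→ℚ (sym (ℕP.+-∸-assoc 1 j<k)) ⟩
      ℕ→ℚ (k ∸ j)              ≡⟨ ℕ→ℚ-∸ k j (ℕP.<⇒≤ j<k) ⟩
      ℕ→ℚ k - ℕ→ℚ j            ≡⟨ swap-neg (ℕ→ℚ k) (ℕ→ℚ j) ⟩
      - ℕ→ℚ j - c              ≡⟨ k-j≡0 ⟩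
      0ℚ                       ∎))
    where
    swap-neg : ∀ a b → a - b ≡ - b - - a
    swap-neg = solve-∀ ℚ-ring

poly-roots : ∀ d g → IsPoly d g → (∀ j → j ≤ d → g (- ℕ→ℚ j) ≡ 0ℚ) → ∀ x → g x ≡ 0ℚ
poly-roots d g (cs , len , ev) roots x =
  trans (sym (ev x)) (evalPoly-roots (suc d) cs len roots-cs x)
  where
  roots-cs : ∀ j → j < suc d → evalPoly cs (- ℕ→ℚ j) ≡ 0ℚ
  roots-cs j j<1+d = trans (ev (- ℕ→ℚ j)) (roots j (ℕP.≤-pred j<1+d))

-- coefP unfolds to invFact p * Π≤ p skip with skip local to coefP; the definitional
-- equation is the only way to name skip.
coefP-factorisation : ∀ β p j → Σ (ℕ → ℚ) λ factor → coefP β p j ≡ invFact p * Π≤ p factor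
coefP-factorisation β p j = _ , refl

coefP-factor : ℚ → ℕ → ℕ → ℕ → ℚ
coefP-factor β p j = proj₁ (coefP-factorisation β p j)

coefP-factor-≡ : ∀ β p j i → i ≡ j → coefP-factor β p j i ≡ 1ℚ
coefP-factor-≡ β p j i i≡j with i ℕ.≟ j
... | yes _   = refl
... | no  i≢j = ⊥-elim (i≢j i≡j)

coefP-factor-≢ : ∀ β p j i → i ≢ j → coefP-factor β p j i ≡ β + ℕ→ℚ i
coefP-factor-≢ β p j i i≢j with i ℕ.≟ j
... | yes i≡j = ⊥-elim (i≢j i≡j)
... | no  _   = refl

Π-coefP-factor-poly-< : ∀ p j k → k < j → IsPoly (suc k) (λ β → Π≤ k (coefP-factor β p j))
Π-coefP-factor-poly-< p j zero    0<j =
  poly-cong (λ β → trans (linear β) (sym (coefP-factor-≢ β p j 0 (λ 0≡j → ℕP.<-irrefl 0≡j 0<j))))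
            (poly-*-affine 1ℚ 0ℚ (poly-const 1ℚ))
  where
  linear : ∀ β → 1ℚ * (1ℚ * β + 0ℚ) ≡ β + 0ℚ
  linear = solve-∀ ℚ-ring
Π-coefP-factor-poly-< p j (suc k) k<j =
  poly-cong (λ β → cong (Π≤ k (coefP-factor β p j) *_)
                        (trans (cong (_+ ℕ→ℚ (suc k)) (*-identityˡ β))
                               (sym (coefP-factor-≢ β p j (suc k) (λ e → ℕP.<-irrefl e k<j)))))
            (poly-*-affine 1ℚ (ℕ→ℚ (suc k)) (Π-coefP-factor-poly-< p j k (ℕP.<-trans ℕP.≤-refl k<j)))

Π-coefP-factor-poly : ∀ p j k → j ≤ k → IsPoly k (λ β → Π≤ k (coefP-factor β p j))
Π-coefP-factor-poly p .zero zero z≤n = poly-cong (λ β → sym (coefP-factor-≡ β p 0 0 refl)) (poly-const 1ℚ)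
Π-coefP-factor-poly p j (suc k) j≤1+k with j ℕ.≟ suc k
... | yes refl = poly-cong (λ β → sym (trans (cong (Π≤ k (coefP-factor β p (suc k)) *_)
                                                   (coefP-factor-≡ β p (suc k) (suc k) refl))
                                             (*-identityʳ _)))
                           (Π-coefP-factor-poly-< p (suc k) k ℕP.≤-refl)
... | no  j≢ = poly-cong (λ β → cong (Π≤ k (coefP-factor β p j) *_)
                                     (trans (cong (_+ ℕ→ℚ (suc k)) (*-identityˡ β))
                                            (sym (coefP-factor-≢ β p j (suc k) (λ e → j≢ (sym e))))))
                         (poly-*-affine 1ℚ (ℕ→ℚ (suc k))
                                        (Π-coefP-factor-poly p j k (ℕP.≤-pred (ℕP.≤∧≢⇒< j≤1+k j≢))))

coefP-poly : ∀ p j → j ≤ p → IsPoly p (λ β → coefP β p j)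
coefP-poly p j j≤p = poly-scale (invFact p) (Π-coefP-factor-poly p j p j≤p)

coefP-other-node : ∀ p j k → k ≤ p → k ≢ j → coefP (- ℕ→ℚ k) p j ≡ 0ℚ
coefP-other-node p j k k≤p k≢j =
  trans (cong (invFact p *_) (Π≤-zero p k _ k≤p (trans (coefP-factor-≢ (- ℕ→ℚ k) p j k k≢j)
                                                      (+-inverseˡ (ℕ→ℚ k)))))
        (*-zeroʳ (invFact p))

Π-coefP-factor-own-node-< : ∀ p k m → m < k →
  Π≤ m (coefP-factor (- ℕ→ℚ k) p k) * ℕ→ℚ ((k ∸ suc m) !) ≡ sgn (suc m) * ℕ→ℚ (k !)
Π-coefP-factor-own-node-< p (suc k) zero 0<k = begin
  coefP-factor (- ℕ→ℚ (suc k)) p (suc k) 0 * ℕ→ℚ (k !)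
    ≡⟨ cong (_* ℕ→ℚ (k !)) (coefP-factor-≢ (- ℕ→ℚ (suc k)) p (suc k) 0 (λ ())) ⟩
  (- ℕ→ℚ (suc k) + 0ℚ) * ℕ→ℚ (k !)
    ≡⟨ rearrange (ℕ→ℚ (suc k)) (ℕ→ℚ (k !)) ⟩
  - 1ℚ * (ℕ→ℚ (suc k) * ℕ→ℚ (k !))
    ≡⟨ cong (- 1ℚ *_) (sym (ℕ→ℚ-* (suc k) (k !))) ⟩
  - 1ℚ * ℕ→ℚ (suc k !) ∎
  where
  rearrange : ∀ a b → (- a + 0ℚ) * b ≡ - 1ℚ * (a * b)
  rearrange = solve-∀ ℚ-ring
Π-coefP-factor-own-node-< p k (suc m) 1+m<k = begin
  (Π≤ m F * F (suc m)) * ℕ→ℚ (d !)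
    ≡⟨ cong (λ z → (Π≤ m F * z) * ℕ→ℚ (d !)) (coefP-factor-≢ (- ℕ→ℚ k) p k (suc m) (λ e → ℕP.<-irrefl e 1+m<k)) ⟩
  (Π≤ m F * (- ℕ→ℚ k + ℕ→ℚ (suc m))) * ℕ→ℚ (d !)
    ≡⟨ rearrange (Π≤ m F) (ℕ→ℚ k) (ℕ→ℚ (suc m)) (ℕ→ℚ (d !)) ⟩
  - (Π≤ m F * ((ℕ→ℚ k - ℕ→ℚ (suc m)) * ℕ→ℚ (d !)))
    ≡⟨ cong (λ z → - (Π≤ m F * (z * ℕ→ℚ (d !)))) (sym k-1-m≡) ⟩
  - (Π≤ m F * (ℕ→ℚ (suc d) * ℕ→ℚ (d !)))
    ≡⟨ cong (λ z → - (Π≤ m F * z)) (sym (ℕ→ℚ-* (suc d) (d !))) ⟩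
  - (Π≤ m F * ℕ→ℚ (suc d !))
    ≡⟨ cong (λ z → - (Π≤ m F * ℕ→ℚ (z !))) (sym k∸m≡) ⟩
  - (Π≤ m F * ℕ→ℚ ((k ∸ suc m) !))
    ≡⟨ cong -_ (Π-coefP-factor-own-node-< p k m (ℕP.<-trans ℕP.≤-refl 1+m<k)) ⟩
  - (sgn (suc m) * ℕ→ℚ (k !))
    ≡⟨ neg-distribˡ-* (sgn (suc m)) (ℕ→ℚ (k !)) ⟩
  sgn (suc (suc m)) * ℕ→ℚ (k !) ∎
  where
  F = coefP-factor (- ℕ→ℚ k) p k
  d = k ∸ suc (suc m)
  k∸m≡ : k ∸ suc m ≡ suc d
  k∸m≡ = ℕP.+-∸-assoc 1 1+m<k
  k-1-m≡ : ℕ→ℚ (suc d) ≡ ℕ→ℚ k - ℕ→ℚ (suc m)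
  k-1-m≡ = trans (cong ℕ→ℚ (sym k∸m≡)) (ℕ→ℚ-∸ k (suc m) (ℕP.<⇒≤ 1+m<k))
  rearrange : ∀ p a b c → (p * (- a + b)) * c ≡ - (p * ((a - b) * c))
  rearrange = solve-∀ ℚ-ring

Π-coefP-factor-own-node : ∀ p k m → k ≤ m →
  Π≤ m (coefP-factor (- ℕ→ℚ k) p k) ≡ sgn k * ℕ→ℚ (k !) * ℕ→ℚ ((m ∸ k) !)
Π-coefP-factor-own-node p zero zero _ = coefP-factor-≡ (- ℕ→ℚ 0) p 0 0 refl
Π-coefP-factor-own-node p k (suc m) k≤1+m with k ℕ.≟ suc m
... | yes refl = begin
  Π≤ m F * F (suc m)                         ≡⟨ cong (Π≤ m F *_) (coefP-factor-≡ (- ℕ→ℚ k) p k k refl) ⟩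
  Π≤ m F * 1ℚ                                ≡⟨ *-identityʳ (Π≤ m F) ⟩
  Π≤ m F                                     ≡⟨ sym (times-0! (Π≤ m F) m) ⟩
  Π≤ m F * ℕ→ℚ ((k ∸ suc m) !)               ≡⟨ Π-coefP-factor-own-node-< p k m ℕP.≤-refl ⟩
  sgn k * ℕ→ℚ (k !)                          ≡⟨ times-0! (sgn k * ℕ→ℚ (k !)) k ⟨
  sgn k * ℕ→ℚ (k !) * ℕ→ℚ ((k ∸ k) !)        ∎
  where
  F = coefP-factor (- ℕ→ℚ k) p k
  times-0! : ∀ x n → x * ℕ→ℚ ((n ∸ n) !) ≡ x
  times-0! x n = trans (cong (λ z → x * ℕ→ℚ (z !)) (ℕP.n∸n≡0 n)) (*-identityʳ x)
... | no  k≢ = begin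
  Π≤ m F * F (suc m)
    ≡⟨ cong₂ _*_ (Π-coefP-factor-own-node p k m k≤m) (coefP-factor-≢ (- ℕ→ℚ k) p k (suc m) (λ e → k≢ (sym e))) ⟩
  (sgn k * ℕ→ℚ (k !) * ℕ→ℚ ((m ∸ k) !)) * (- ℕ→ℚ k + ℕ→ℚ (suc m))
    ≡⟨ rearrange (sgn k * ℕ→ℚ (k !)) (ℕ→ℚ ((m ∸ k) !)) (ℕ→ℚ k) (ℕ→ℚ (suc m)) ⟩
  sgn k * ℕ→ℚ (k !) * ((ℕ→ℚ (suc m) - ℕ→ℚ k) * ℕ→ℚ ((m ∸ k) !))
    ≡⟨ cong (λ z → sgn k * ℕ→ℚ (k !) * (z * ℕ→ℚ ((m ∸ k) !))) (sym 1+m-k≡) ⟩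
  sgn k * ℕ→ℚ (k !) * (ℕ→ℚ (suc (m ∸ k)) * ℕ→ℚ ((m ∸ k) !))
    ≡⟨ cong (sgn k * ℕ→ℚ (k !) *_) (sym (ℕ→ℚ-* (suc (m ∸ k)) ((m ∸ k) !))) ⟩
  sgn k * ℕ→ℚ (k !) * ℕ→ℚ (suc (m ∸ k) !)
    ≡⟨ cong (λ z → sgn k * ℕ→ℚ (k !) * ℕ→ℚ (z !)) (sym 1+m∸k≡) ⟩
  sgn k * ℕ→ℚ (k !) * ℕ→ℚ ((suc m ∸ k) !) ∎
  where
  F = coefP-factor (- ℕ→ℚ k) p k
  k≤m : k ≤ m
  k≤m = ℕP.≤-pred (ℕP.≤∧≢⇒< k≤1+m k≢)
  1+m∸k≡ : suc m ∸ k ≡ suc (m ∸ k)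
  1+m∸k≡ = ℕP.+-∸-assoc 1 k≤m
  1+m-k≡ : ℕ→ℚ (suc (m ∸ k)) ≡ ℕ→ℚ (suc m) - ℕ→ℚ k
  1+m-k≡ = trans (cong ℕ→ℚ (sym 1+m∸k≡)) (ℕ→ℚ-∸ (suc m) k k≤1+m)
  rearrange : ∀ a f x y → (a * f) * (- x + y) ≡ a * ((y - x) * f)
  rearrange = solve-∀ ℚ-ring

coefP-own-node : ∀ p k → k ≤ p → coefP (- ℕ→ℚ k) p k * sgn k * ℕ→ℚ (p C k) ≡ 1ℚ
coefP-own-node p k k≤p = begin
  invFact p * Π≤ p (coefP-factor (- ℕ→ℚ k) p k) * sgn k * ℕ→ℚ (p C k)
    ≡⟨ cong (λ z → invFact p * z * sgn k * ℕ→ℚ (p C k)) (Π-coefP-factor-own-node p k p k≤p) ⟩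
  invFact p * (sgn k * ℕ→ℚ (k !) * ℕ→ℚ ((p ∸ k) !)) * sgn k * ℕ→ℚ (p C k)
    ≡⟨ regroup (invFact p) (sgn k) (ℕ→ℚ (k !)) (ℕ→ℚ ((p ∸ k) !)) (ℕ→ℚ (p C k)) ⟩
  invFact p * ((sgn k * sgn k) * (ℕ→ℚ (p C k) * (ℕ→ℚ (k !) * ℕ→ℚ ((p ∸ k) !))))
    ≡⟨ cong₂ (λ u v → invFact p * (u * v)) (sgn-*-sgn k) C*!*!≡p! ⟩
  invFact p * (1ℚ * ℕ→ℚ (p !))
    ≡⟨ cong (invFact p *_) (*-identityˡ (ℕ→ℚ (p !))) ⟩
  invFact p * ℕ→ℚ (p !)
    ≡⟨ invFact-*-! p ⟩
  1ℚ ∎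
  where
  regroup : ∀ i s a b c → i * (s * a * b) * s * c ≡ i * ((s * s) * (c * (a * b)))
  regroup = solve-∀ ℚ-ring
  C*!*!≡p! : ℕ→ℚ (p C k) * (ℕ→ℚ (k !) * ℕ→ℚ ((p ∸ k) !)) ≡ ℕ→ℚ (p !)
  C*!*!≡p! = begin
    ℕ→ℚ (p C k) * (ℕ→ℚ (k !) * ℕ→ℚ ((p ∸ k) !))   ≡⟨ cong (ℕ→ℚ (p C k) *_) (sym (ℕ→ℚ-* (k !) ((p ∸ k) !))) ⟩
    ℕ→ℚ (p C k) * ℕ→ℚ (k ! *ℕ (p ∸ k) !)          ≡⟨ sym (ℕ→ℚ-* (p C k) (k ! *ℕ (p ∸ k) !)) ⟩
    ℕ→ℚ ((p C k) *ℕ (k ! *ℕ (p ∸ k) !))           ≡⟨ cong ℕ→ℚ (C*!*!≡! p k k≤p) ⟩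
    ℕ→ℚ (p !)                                     ∎

interpolant : ℕ → (ℕ → ℚ) → ℚ → ℚ
interpolant p y β = Σ≤ p (λ j → coefP β p j * sgn j * ℕ→ℚ (p C j) * y j)

interpolant-poly : ∀ p y → IsPoly p (interpolant p y)
interpolant-poly p y = poly-Σ≤ p _ λ j j≤p →
  poly-cong (λ β → commute (coefP β p j) (sgn j) (ℕ→ℚ (p C j)) (y j))
            (poly-scale (sgn j * ℕ→ℚ (p C j) * y j) (coefP-poly p j j≤p))
  where
  commute : ∀ a s c x → (s * c * x) * a ≡ a * s * c * x
  commute = solve-∀ ℚ-ring

interpolant-node : ∀ p y k → k ≤ p → interpolant p y (- ℕ→ℚ k) ≡ y k
interpolant-node p y k k≤p = begin
  interpolant p y (- ℕ→ℚ k)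
    ≡⟨ Σ≤-single p k _ k≤p other≡0 ⟩
  coefP (- ℕ→ℚ k) p k * sgn k * ℕ→ℚ (p C k) * y k
    ≡⟨ cong (_* y k) (coefP-own-node p k k≤p) ⟩
  1ℚ * y k
    ≡⟨ *-identityˡ (y k) ⟩
  y k ∎
  where
  annihilate : ∀ s c x → 0ℚ * s * c * x ≡ 0ℚ
  annihilate = solve-∀ ℚ-ring
  other≡0 : ∀ j → j ≢ k → coefP (- ℕ→ℚ k) p j * sgn j * ℕ→ℚ (p C j) * y j ≡ 0ℚ
  other≡0 j j≢k = trans (cong (λ z → z * sgn j * ℕ→ℚ (p C j) * y j)
                              (coefP-other-node p j k k≤p (λ e → j≢k (sym e))))
                        (annihilate (sgn j) (ℕ→ℚ (p C j)) (y j))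

lagrange-interpolation : ∀ p g → IsPoly p g → ∀ β → g β ≡ interpolant p (λ j → g (- ℕ→ℚ j)) β
lagrange-interpolation p g g-poly β = begin
  g β                  ≡⟨ split (g β) (R β) ⟩
  (g β - R β) + R β    ≡⟨ cong (_+ R β) (poly-roots p (λ x → g x - R x) difference-poly roots β) ⟩
  0ℚ + R β             ≡⟨ +-identityˡ (R β) ⟩
  R β                  ∎
  where
  R = interpolant p (λ j → g (- ℕ→ℚ j))
  split : ∀ a b → a ≡ (a - b) + b
  split = solve-∀ ℚ-ring
  difference-poly : IsPoly p (λ x → g x - R x)
  difference-poly = poly-+ g-poly (poly-neg (interpolant-poly p _))
  roots : ∀ j → j ≤ p → g (- ℕ→ℚ j) - R (- ℕ→ℚ j) ≡ 0ℚ
  roots j j≤p = trans (cong (λ z → g (- ℕ→ℚ j) - z) (interpolant-node p _ j j≤p))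
                      (+-inverseʳ (g (- ℕ→ℚ j)))

binom-affine-poly : ∀ u v m → IsPoly m (λ β → binom (u * β + v) m)
binom-affine-poly u v zero    = poly-const 1ℚ
binom-affine-poly u v (suc m) =
  poly-cong (λ β → rearrange (recipℕ (suc m)) (binom (u * β + v) m) u β v (ℕ→ℚ m))
            (poly-scale (recipℕ (suc m)) (poly-*-affine u (v - ℕ→ℚ m) (binom-affine-poly u v m)))
  where
  rearrange : ∀ r B u β v k → r * (B * (u * β + (v - k))) ≡ B * ((u * β + v) - k) * r
  rearrange = solve-∀ ℚ-ring

powS-affine-poly : ∀ f u v n → IsPoly n (λ β → powS f (u * β + v) n)
powS-affine-poly f u v n = poly-Σ≤ n _ λ k k≤n →
  poly-weaken k≤n (poly-cong (λ β → *-comm ((minus1 f ^S k) n) (binom (u * β + v) k))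
                             (poly-scale ((minus1 f ^S k) n) (binom-affine-poly u v k)))

powS-⊗-affine-poly : ∀ f g u v n → IsPoly n (λ β → (powS f (u * β + v) ⊗ g) n)
powS-⊗-affine-poly f g u v n = poly-Σ≤ n _ λ i i≤n →
  poly-weaken i≤n (poly-cong (λ β → *-comm (g (n ∸ i)) (powS f (u * β + v) i))
                             (poly-scale (g (n ∸ i)) (powS-affine-poly f u v i)))

bernoulliB-affine-poly : ∀ n x u v → IsPoly n (λ β → bernoulliB n (u * β + v) x)
bernoulliB-affine-poly n x u v =
  poly-scale (ℕ→ℚ (n !))
    (poly-cong (λ β → cong (λ a → (powS expm1/t a ⊗ expS x) n) (negate u β v))
               (powS-⊗-affine-poly expm1/t (expS x) (- u) (- v) n))
  where
  negate : ∀ u β v → - u * β + - v ≡ - (u * β + v)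
  negate = solve-∀ ℚ-ring

bernoulliB2-affine-poly : ∀ n x u v → IsPoly n (λ β → bernoulliB2 n (u * β + v) x)
bernoulliB2-affine-poly n x u v =
  poly-scale (ℕ→ℚ (n !))
    (poly-cong (λ β → cong (λ a → (powS log1p/t a ⊗ powS onePlusT x) n) (negate u β v))
               (powS-⊗-affine-poly log1p/t (powS onePlusT x) (- u) (- v) n))
  where
  negate : ∀ u β v → - u * β + - v ≡ - (u * β + v)
  negate = solve-∀ ℚ-ring

bernoulliB-neg : ∀ n m r →
  bernoulliB n (- ℕ→ℚ m) (ℕ→ℚ r) ≡ rStirling r (n +ℕ m) m * recipℕ ((n +ℕ m) C n)
bernoulliB-neg n m r = begin
  ℕ→ℚ (n !) * (powS expm1/t (- - ℕ→ℚ m) ⊗ e) n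
    ≡⟨ cong (λ a → ℕ→ℚ (n !) * (powS expm1/t a ⊗ e) n) (double-negation (ℕ→ℚ m)) ⟩
  ℕ→ℚ (n !) * (powS expm1/t (ℕ→ℚ m) ⊗ e) n
    ≡⟨ cong (ℕ→ℚ (n !) *_) (⊗-cong (powS-ℕ expm1/t refl m) (≈-refl {e}) n) ⟩
  ℕ→ℚ (n !) * expSide r m n
    ≡⟨ n!*expSide≡rStirling/C r n m ⟩
  rStirling r (n +ℕ m) m * recipℕ ((n +ℕ m) C n) ∎
  where
  e = expS (ℕ→ℚ r)
  double-negation : ∀ x → - - x ≡ x
  double-negation = solve-∀ ℚ-ring

bernoulliB2-at : ∀ n m r →
  bernoulliB2 n (ℕ→ℚ (suc (n +ℕ m))) (ℕ→ℚ r) ≡ rStirling (suc r) (n +ℕ m) m * recipℕ ((n +ℕ m) C n)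
bernoulliB2-at n m r = begin
  ℕ→ℚ (n !) * logSide r (suc (n +ℕ m)) n   ≡⟨ cong (ℕ→ℚ (n !) *_) (logSide≡expSide r n m) ⟩
  ℕ→ℚ (n !) * expSide (suc r) m n          ≡⟨ n!*expSide≡rStirling/C (suc r) n m ⟩
  rStirling (suc r) (n +ℕ m) m * recipℕ ((n +ℕ m) C n) ∎

lagrange-expansion : ∀ p {d} g → d ≤ p → IsPoly d g → ∀ β (y : ℕ → ℚ) (z : ℕ → ℚ) →
  (∀ j → g (- ℕ→ℚ j) ≡ y j * z j) →
  g β ≡ Σ≤ p (λ j → coefP β p j * sgn j * ℕ→ℚ (p C j) * y j * z j)
lagrange-expansion p g d≤p g-poly β y z nodes =
  trans (lagrange-interpolation p g (poly-weaken d≤p g-poly) β)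
        (Σ≤-cong′ p λ j → trans (cong (coefP β p j * sgn j * ℕ→ℚ (p C j) *_) (nodes j))
                                (sym (*-assoc (coefP β p j * sgn j * ℕ→ℚ (p C j)) (y j) (z j))))

bernoulliB-expansion : ∀ (α : ℚ) (p q r n : ℕ) → n ≤ p →
  bernoulliB n α (ℕ→ℚ r)
    ≡ Σ≤ p (λ j → coefP (α + ℕ→ℚ q) p j * sgn j * ℕ→ℚ (p C j)
                  * rStirling r (n +ℕ q +ℕ j) (q +ℕ j) * recipℕ ((n +ℕ q +ℕ j) C n))
bernoulliB-expansion α p q r n n≤p = begin
  bernoulliB n α (ℕ→ℚ r)          ≡⟨ cong (λ a → bernoulliB n a (ℕ→ℚ r)) (shift α (ℕ→ℚ q)) ⟩
  g (α + ℕ→ℚ q)                   ≡⟨ lagrange-expansion p g n≤p (bernoulliB-affine-poly n (ℕ→ℚ r) 1ℚ (- ℕ→ℚ q))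
                                                        (α + ℕ→ℚ q) _ _ node ⟩
  _                               ∎
  where
  g : ℚ → ℚ
  g β = bernoulliB n (1ℚ * β + - ℕ→ℚ q) (ℕ→ℚ r)
  shift : ∀ a b → a ≡ 1ℚ * (a + b) + - b
  shift = solve-∀ ℚ-ring
  exponent : ∀ j → 1ℚ * - ℕ→ℚ j + - ℕ→ℚ q ≡ - ℕ→ℚ (q +ℕ j)
  exponent j = trans (negate-sum (ℕ→ℚ j) (ℕ→ℚ q)) (cong -_ (sym (ℕ→ℚ-+ q j)))
    where
    negate-sum : ∀ a b → 1ℚ * - a + - b ≡ - (b + a)
    negate-sum = solve-∀ ℚ-ring
  node : ∀ j → g (- ℕ→ℚ j) ≡ rStirling r (n +ℕ q +ℕ j) (q +ℕ j) * recipℕ ((n +ℕ q +ℕ j) C n)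
  node j = begin
    g (- ℕ→ℚ j)                        ≡⟨ cong (λ a → bernoulliB n a (ℕ→ℚ r)) (exponent j) ⟩
    bernoulliB n (- ℕ→ℚ (q +ℕ j)) (ℕ→ℚ r) ≡⟨ bernoulliB-neg n (q +ℕ j) r ⟩
    rStirling r (n +ℕ (q +ℕ j)) (q +ℕ j) * recipℕ ((n +ℕ (q +ℕ j)) C n)
      ≡⟨ cong (λ N → rStirling r N (q +ℕ j) * recipℕ (N C n)) (sym (ℕP.+-assoc n q j)) ⟩
    rStirling r (n +ℕ q +ℕ j) (q +ℕ j) * recipℕ ((n +ℕ q +ℕ j) C n) ∎

bernoulliB2-expansion : ∀ (α : ℚ) (p q r n : ℕ) → n ≤ p →
  bernoulliB2 n α (ℕ→ℚ r)
    ≡ Σ≤ p (λ j → coefP (ℕ→ℚ (n +ℕ 1) - α + ℕ→ℚ q) p j * sgn j * ℕ→ℚ (p C j)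
                  * rStirling (r +ℕ 1) (n +ℕ q +ℕ j) (q +ℕ j) * recipℕ ((n +ℕ q +ℕ j) C n))
bernoulliB2-expansion α p q r n n≤p = begin
  bernoulliB2 n α (ℕ→ℚ r)         ≡⟨ cong (λ a → bernoulliB2 n a (ℕ→ℚ r)) (reflect α (ℕ→ℚ (n +ℕ 1)) (ℕ→ℚ q)) ⟩
  g β₀                            ≡⟨ lagrange-expansion p g n≤p (bernoulliB2-affine-poly n (ℕ→ℚ r) (- 1ℚ) c)
                                                        β₀ _ _ node ⟩
  _                               ∎
  where
  c  = ℕ→ℚ (n +ℕ 1) + ℕ→ℚ q
  β₀ = ℕ→ℚ (n +ℕ 1) - α + ℕ→ℚ q
  g : ℚ → ℚ
  g β = bernoulliB2 n (- 1ℚ * β + c) (ℕ→ℚ r)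
  reflect : ∀ a N q → a ≡ - 1ℚ * (N - a + q) + (N + q)
  reflect = solve-∀ ℚ-ring
  exponent : ∀ j → - 1ℚ * - ℕ→ℚ j + c ≡ ℕ→ℚ (suc (n +ℕ (q +ℕ j)))
  exponent j = begin
    - 1ℚ * - ℕ→ℚ j + (ℕ→ℚ (n +ℕ 1) + ℕ→ℚ q)        ≡⟨ cong (λ N → - 1ℚ * - ℕ→ℚ j + (N + ℕ→ℚ q)) (ℕ→ℚ-+ n 1) ⟩
    - 1ℚ * - ℕ→ℚ j + ((ℕ→ℚ n + 1ℚ) + ℕ→ℚ q)        ≡⟨ collect (ℕ→ℚ j) (ℕ→ℚ n) (ℕ→ℚ q) ⟩
    1ℚ + (ℕ→ℚ n + (ℕ→ℚ q + ℕ→ℚ j))                 ≡⟨ cong (λ z → 1ℚ + (ℕ→ℚ n + z)) (sym (ℕ→ℚ-+ q j)) ⟩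
    1ℚ + (ℕ→ℚ n + ℕ→ℚ (q +ℕ j))                    ≡⟨ cong (1ℚ +_) (sym (ℕ→ℚ-+ n (q +ℕ j))) ⟩
    1ℚ + ℕ→ℚ (n +ℕ (q +ℕ j))                       ≡⟨ sym (ℕ→ℚ-suc (n +ℕ (q +ℕ j))) ⟩
    ℕ→ℚ (suc (n +ℕ (q +ℕ j)))                      ∎
    where
    collect : ∀ j n q → - 1ℚ * - j + ((n + 1ℚ) + q) ≡ 1ℚ + (n + (q + j))
    collect = solve-∀ ℚ-ring
  node : ∀ j → g (- ℕ→ℚ j) ≡ rStirling (r +ℕ 1) (n +ℕ q +ℕ j) (q +ℕ j) * recipℕ ((n +ℕ q +ℕ j) C n)
  node j = begin
    g (- ℕ→ℚ j)                                   ≡⟨ cong (λ a → bernoulliB2 n a (ℕ→ℚ r)) (exponent j) ⟩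
    bernoulliB2 n (ℕ→ℚ (suc (n +ℕ (q +ℕ j)))) (ℕ→ℚ r) ≡⟨ bernoulliB2-at n (q +ℕ j) r ⟩
    rStirling (suc r) (n +ℕ (q +ℕ j)) (q +ℕ j) * recipℕ ((n +ℕ (q +ℕ j)) C n)
      ≡⟨ cong₂ (λ N s → rStirling s N (q +ℕ j) * recipℕ (N C n)) (sym (ℕP.+-assoc n q j)) (ℕP.+-comm 1 r) ⟩
    rStirling (r +ℕ 1) (n +ℕ q +ℕ j) (q +ℕ j) * recipℕ ((n +ℕ q +ℕ j) C n) ∎

proposition2 : (α : ℚ) (p q r n : ℕ) → n ≤ p →
    (bernoulliB n α (ℕ→ℚ r)
      ≡ Σ≤ p (λ j → coefP (α + ℕ→ℚ q) p j * sgn j * ℕ→ℚ (p C j)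
                    * rStirling r (n +ℕ q +ℕ j) (q +ℕ j)
                    * recipℕ ((n +ℕ q +ℕ j) C n)))
    × (bernoulliB2 n α (ℕ→ℚ r)
      ≡ Σ≤ p (λ j → coefP (ℕ→ℚ (n +ℕ 1) - α + ℕ→ℚ q) p j * sgn j * ℕ→ℚ (p C j)
                    * rStirling (r +ℕ 1) (n +ℕ q +ℕ j) (q +ℕ j)
                    * recipℕ ((n +ℕ q +ℕ j) C n)))
proposition2 α p q r n n≤p = bernoulliB-expansion α p q r n n≤p , bernoulliB2-expansion α p q r n n≤p
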